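{- Let $(R_S,C_S)$ be the $2n\times2n$ game defined in the context, and let $\varepsilon\in[0,1/3)$. If $(x,y)$ is an $\varepsilon$-WNE of $(R_S,C_S)$, then (i) $\mathrm{supp}(x^L)\subseteq S$ and $\mathrm{supp}(y^R)\subseteq S$; and (ii) $\|x^L-\tfrac12u_{n,S}\|_1\le17\varepsilon$ and $\|y^R-\tfrac12u_{n,S}\|_1\le17\varepsilon$.
   Context: Let $l\ge2$ be even, $n=\binom{l}{l/2}$, and $S\subseteq[n]$ with $|S|=l$. Fix an enumeration $S_1,\dots,S_n$ of the $(l/2)$-element subsets of $S$. Define $n\times n$ matrices $A_S,B_S$: for each column $j\in[n]$, $A_S(i,j)=-1,B_S(i,j)=1$ if $i\notin S$; $A_S(i,j)=1,B_S(i,j)=0$ if $i\in S\cap S_j$; $A_S(i,j)=0,B_S(i,j)=1$ if $i\in S\setminus S_j$. Define the $2n\times2n$ block matrices $$R_S=\begin{pmatrix}2J+A_S & -2J\\ -2J & 2J+B_S^\top\end{pmatrix},\qquad C_S=\begin{pmatrix}-2J+B_S & 2J\\ 2J & -2J+A_S^\top\end{pmatrix},$$ with $J$ the $n\times n$ all-ones matrix. For $x\in\mathbb{R}^{2n}$ write $x^L=(x_1,\dots,x_n)$, $x^R=(x_{n+1},\dots,x_{2n})$ (vectors in $\mathbb{R}^n$, indexed by $[n]$), and $\mathrm{supp}(v)$ is the set of nonzero coordinates. $u_{n,S}\in\mathbb{R}^n$ is the uniform distribution on $S$ (coordinate $1/|S|$ on $S$, $0$ elsewhere). For a game $(R,C)$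 with mixed strategies in $\Delta_m=\{x\in[0,1]^m:\sum x_i=1\}$ and pure strategies $e_i$, $(x,y)$ is an $\varepsilon$-WNE if $x_i>0\Rightarrow e_i^\top Ry\ge\max_ke_k^\top Ry-\varepsilon$ and $y_j>0\Rightarrow x^\top Ce_j\ge\max_kx^\top Ce_k-\varepsilon$.
   Formalization: The parameter ε is rational and the mixed strategies x, y have rational entries, lying in ℚ^(2n) instead of ℝ^(2n). -}

module Defs where

open import Data.Nat using (ℕ; zero; suc)
import Data.Nat as ℕ
open import Data.Integer using (+_)
open import Data.Rational using (ℚ; 0ℚ; 1ℚ; _+_; _*_; _-_; -_; _≤_; _<_; _/_; ∣_∣)
open import Data.Fin using (Fin; splitAt; _↑ˡ_; _↑ʳ_)
open import Data.Fin.Subset using (Subset; _∈_)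
open import Data.Fin.Subset.Properties using (_∈?_)
open import Data.Sum using (inj₁; inj₂)
open import Relation.Nullary using (yes; no; ¬_)
open import Relation.Binary.PropositionalEquality using (_≡_)

sumF : ∀ {m} → (Fin m → ℚ) → ℚ
sumF {zero}  f = 0ℚ
sumF {suc m} f = f Fin.zero + sumF (λ i → f (Fin.suc i))
  where import Data.Fin as Fin

Matrix : ℕ → ℕ → Set
Matrix m k = Fin m → Fin k → ℚ

two : ℚ
two = + 2 / 1

-- A_S and B_S, given S and the enumeration T j = S_j of the (l/2)-subsets of S.
A-mat : ∀ {n} → Subset n → (Fin n → Subset n) → Matrix n n
A-mat S T i j with i ∈? S | i ∈? T j
... | no _  | _     = - 1ℚ
... | yes _ | yes _ = 1ℚ
... | yes _ | no _  = 0ℚ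

B-mat : ∀ {n} → Subset n → (Fin n → Subset n) → Matrix n n
B-mat S T i j with i ∈? S | i ∈? T j
... | no _  | _     = 1ℚ
... | yes _ | yes _ = 0ℚ
... | yes _ | no _  = 1ℚ

R-mat : ∀ {n} → Subset n → (Fin n → Subset n) → Matrix (n ℕ.+ n) (n ℕ.+ n)
R-mat {n} S T i j with splitAt n i | splitAt n j
... | inj₁ a | inj₁ b = two + A-mat S T a b
... | inj₁ a | inj₂ b = - two
... | inj₂ a | inj₁ b = - two
... | inj₂ a | inj₂ b = two + B-mat S T b a

C-mat : ∀ {n} → Subset n → (Fin n → Subset n) → Matrix (n ℕ.+ n) (n ℕ.+ n)
C-mat {n} S T i j with splitAt n i | splitAt n j
... | inj₁ a | inj₁ b = - two + B-mat S T a b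
... | inj₁ a | inj₂ b = two
... | inj₂ a | inj₁ b = two
... | inj₂ a | inj₂ b = - two + A-mat S T b a

IsMixed : ∀ {m} → (Fin m → ℚ) → Set
IsMixed x = (∀ i → 0ℚ ≤ x i × x i ≤ 1ℚ) × sumF x ≡ 1ℚ
  where open import Data.Product using (_×_)

rowPayoff : ∀ {m} → Matrix m m → (Fin m → ℚ) → Fin m → ℚ
rowPayoff R y i = sumF (λ j → R i j * y j)

colPayoff : ∀ {m} → Matrix m m → (Fin m → ℚ) → Fin m → ℚ
colPayoff C x j = sumF (λ i → x i * C i j)

-- ε-well-supported Nash equilibrium; "≥ max_k (…) - ε" is written as "≥ (…)_k - ε for all k".
IsWNE : ∀ {m} → ℚ → Matrix m m → Matrix m m → (Fin m → ℚ) → (Fin m → ℚ) → Set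
IsWNE ε R C x y =
  IsMixed x × IsMixed y
  × (∀ i → 0ℚ < x i → ∀ k → rowPayoff R y k - ε ≤ rowPayoff R y i)
  × (∀ j → 0ℚ < y j → ∀ k → colPayoff C x k - ε ≤ colPayoff C x j)
  where open import Data.Product using (_×_)

left : ∀ {n} → (Fin (n ℕ.+ n) → ℚ) → Fin n → ℚ
left {n} x i = x (i ↑ˡ n)

right : ∀ {n} → (Fin (n ℕ.+ n) → ℚ) → Fin n → ℚ
right {n} x i = x (n ↑ʳ i)

SuppIn : ∀ {n} → (Fin n → ℚ) → Subset n → Set
SuppIn v S = ∀ i → ¬ (v i ≡ 0ℚ) → i ∈ S

-- ½ u_{n,S} for |S| = l (l nonzero): coordinate 1/(2l) on S, 0 elsewhere.
halfUniform : ∀ {n} (l : ℕ) .{{_ : ℕ.NonZero l}} → Subset n → Fin n → ℚ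
halfUniform l S i with i ∈? S
... | yes _ = (+ 1 / l) * (+ 1 / 2)
... | no _  = 0ℚ

dist1 : ∀ {n} → (Fin n → ℚ) → (Fin n → ℚ) → ℚ
dist1 v w = sumF (λ i → ∣ v i - w i ∣)

{-# OPTIONS --safe #-}
-- Write a and b for the masses that x and y put on their left halves.  Once both supports lie
-- in S, the game is zero-sum up to terms in a and b alone: A_S + B_S = χ_S 1ᵀ, so the bilinear
-- parts of the two players' block payoffs cancel.  Comparing single pure strategies first gives
-- 1/3 ≤ a, b ≤ 2/3 and rules out support outside S.  Averaging the well-supportedness conditions
-- over S, where each element lies in exactly half of the sets T j, and combining a row and a
-- column condition through the zero-sum identity gives |a - 1/2| ≤ ε, |b - 1/2| ≤ ε, and that
-- every T j carries half of the mass of x^L (and of y^R) up to 4ε.  Finally, a weight on S whose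
-- (l/2)-subsets all carry half its mass up to δ is within 4δ of constant in ℓ₁: by an exchange
-- argument the heaviest such subset holds the l/2 largest weights, and its complement is again
-- one of the T j.  This yields 4·4ε + ε = 17ε.
module Submission where

open import Defs

-- A module of its own keeps the ℚ operators below apart from the ℕ ones of the statement.
module _ where
  open import Algebra.Bundles using (CommutativeRing)
  open import Data.Bool using (true; false; if_then_else_)
  open import Data.Empty using (⊥-elim)
  open import Data.Fin using (Fin; zero; suc; _↑ˡ_; _↑ʳ_)
  open import Data.Fin.Properties using (splitAt-↑ˡ; splitAt-↑ʳ)
  open import Data.Fin.Subset using (Subset; _∈_; _∉_; _⊆_; _─_; inside; outside) renaming (∣_∣ to size; ⊥ to ∅)
  open import Data.Fin.Subset.Properties using (_∈?_; ⊆-min; ∣⊥∣≡0; s⊆s; drop-∷-⊆; p─q⊆p)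
  open import Data.Integer as ℤ using (+_)
  import Data.Integer.Properties as ℤ
  open import Data.List using (allFin; filter)
  open import Data.List.Membership.Propositional.Properties using (∈-allFin; ∈-filter⁺)
  import Data.List.Relation.Unary.All as All
  open import Data.List.Relation.Unary.All.Properties using (all-filter)
  open import Data.Nat as ℕ using (ℕ; zero; suc)
  import Data.Nat.Properties as ℕ
  open import Data.Product using (_×_; _,_; ∃; proj₁; proj₂)
  open import Data.Rational using (ℚ; 0ℚ; 1ℚ; _+_; _*_; _-_; -_; _/_; _≤_; _<_; ∣_∣; positive; nonNegative; toℚᵘ)
  open import Data.Rational.Properties
  open import Data.Rational.Solver using (module +-*-Solver)
  import Data.Rational.Unnormalised as ℚᵘ
  import Data.Rational.Unnormalised.Properties as ℚᵘ
  open import Data.Sum using (_⊎_; inj₁; inj₂)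
  open import Data.Vec using ([]; _∷_; lookup; _[_]≔_; here; there)
  import Data.Vec.Properties as Vec
  open import Function using (_∘_)
  open import Relation.Binary.Bundles using (DecTotalOrder)
  open import Relation.Binary.PropositionalEquality
  open import Relation.Nullary using (yes; no; Dec)
  open import Relation.Nullary.Decidable using (toWitness)

  open +-*-Solver using (solve; _:+_; _:-_; _:*_; :-_; con; _:=_)
  open import Algebra.Properties.Group +-0-group using () renaming (∙-cancelʳ to +-cancelʳ)
  open import Algebra.Properties.Monoid.Mult +-0-monoid using () renaming (_×_ to _·_; ×-homo-+ to ·-homo-+)
  open import Algebra.Properties.Semiring.Sum (CommutativeRing.semiring +-*-commutativeRing)
    using (sum-syntax; ∑-distrib-+; ∑-comm; *-distribˡ-sum; *-distribʳ-sum; sum-cong-≗; sum-replicate-zero)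
  open import Data.List.Extrema (DecTotalOrder.totalOrder ≤-decTotalOrder)
    using (argmax; argmin; f[xs]≤f[argmax]; f[argmin]≤f[xs]; argmin-all)

  ½ ⅓ : ℚ
  ½ = + 1 / 2
  ⅓ = + 1 / 3

  0≤-gap : ∀ {p q} → p ≤ q → 0ℚ ≤ q - p
  0≤-gap {p} {q} p≤q = subst (_≤ q - p) (+-inverseʳ p) (+-monoˡ-≤ (- p) p≤q)

  -- Most inequalities below are certificates: the gap q - p is given as a nonnegative
  -- combination of known gaps, and the ring solver checks the identity.
  ≤-by-gap : ∀ {p q g} → 0ℚ ≤ g → g ≡ q - p → p ≤ q
  ≤-by-gap {p} {q} 0≤g g≡q-p = subst₂ _≤_ (+-identityʳ p) p+[q-p]≡q (+-monoʳ-≤ p (subst (0ℚ ≤_) g≡q-p 0≤g))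
    where
    p+[q-p]≡q : p + (q - p) ≡ q
    p+[q-p]≡q = solve 2 (λ p q → p :+ (q :- p) := q) refl p q

  0≤* : ∀ {p q} → 0ℚ ≤ p → 0ℚ ≤ q → 0ℚ ≤ p * q
  0≤* {p} {q} 0≤p 0≤q = subst (_≤ p * q) (*-zeroʳ p) (*-monoˡ-≤-nonNeg p {{nonNegative 0≤p}} 0≤q)

  +≡+⇒≤ : ∀ {a b x y} → a ≤ b → a + x ≡ b + y → y ≤ x
  +≡+⇒≤ {a} {b} {x} {y} a≤b a+x≡b+y = ≤-by-gap (0≤-gap a≤b) (begin
    b - a             ≡⟨ solve 3 (λ a b y → b :- a := (b :+ y) :- (a :+ y)) refl a b y ⟩
    (b + y) - (a + y) ≡⟨ cong (_- (a + y)) (sym a+x≡b+y) ⟩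
    (a + x) - (a + y) ≡⟨ solve 3 (λ a x y → (a :+ x) :- (a :+ y) := x :- y) refl a x y ⟩
    x - y             ∎)
    where open ≡-Reasoning

  ≤∧≢0⇒0< : ∀ {p} → 0ℚ ≤ p → p ≢ 0ℚ → 0ℚ < p
  ≤∧≢0⇒0< {p} 0≤p p≢0 with 0ℚ <? p
  ... | yes 0<p = 0<p
  ... | no  0≮p = ⊥-elim (p≢0 (≤-antisym (≮⇒≥ 0≮p) 0≤p))

  ⅓≤⇒0< : ∀ {p} → ⅓ ≤ p → 0ℚ < p
  ⅓≤⇒0< = <-≤-trans (positive⁻¹ ⅓)

  ∣p-q∣≡∣q-p∣ : ∀ p q → ∣ p - q ∣ ≡ ∣ q - p ∣
  ∣p-q∣≡∣q-p∣ p q = trans (cong ∣_∣ (solve 2 (λ p q → p :- q := :- (q :- p)) refl p q)) (∣-p∣≡∣p∣ (q - p))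

  p≤q⇒∣p-q∣≡q-p : ∀ {p q} → p ≤ q → ∣ p - q ∣ ≡ q - p
  p≤q⇒∣p-q∣≡q-p {p} {q} p≤q = trans (∣p-q∣≡∣q-p∣ p q) (0≤p⇒∣p∣≡p (0≤-gap p≤q))

  ∣p-q∣≤ : ∀ {p q e} → p - q ≤ e → q - p ≤ e → ∣ p - q ∣ ≤ e
  ∣p-q∣≤ {p} {q} p-q≤e q-p≤e with ∣p∣≡p∨∣p∣≡-p (p - q)
  ... | inj₁ ∣p-q∣≡p-q = subst (_≤ _) (sym ∣p-q∣≡p-q) p-q≤e
  ... | inj₂ ∣p-q∣≡q-p = subst (_≤ _) (sym (trans ∣p-q∣≡q-p (solve 2 (λ p q → :- (p :- q) := q :- p) refl p q))) q-p≤e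

  p-q≤r⇒p-r≤q : ∀ {p q r} → p - q ≤ r → p - r ≤ q
  p-q≤r⇒p-r≤q {p} {q} {r} p-q≤r = ≤-by-gap (0≤-gap p-q≤r) (solve 3 (λ p q r → r :- (p :- q) := q :- (p :- r)) refl p q r)

  c*d≤4e⇒d≤e : ∀ {c d e} → + 4 / 1 ≤ c → 0ℚ ≤ e → c * d ≤ + 4 / 1 * e → d ≤ e
  c*d≤4e⇒d≤e {c} {d} {e} 4≤c 0≤e cd≤4e with ≤-total d 0ℚ
  ... | inj₁ d≤0 = ≤-trans d≤0 0≤e
  ... | inj₂ 0≤d = *-cancelˡ-≤-pos (+ 4 / 1) (≤-trans (*-monoʳ-≤-nonNeg d {{nonNegative 0≤d}} 4≤c) cd≤4e)

  m*d≤e*[l+m]⇒d≤4e : ∀ {l m d e} → 0ℚ ≤ e → l ≤ 1ℚ → ⅓ ≤ m → m * d ≤ e * (l + m) → d ≤ + 4 / 1 * e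
  m*d≤e*[l+m]⇒d≤4e {l} {m} {d} {e} 0≤e l≤1 ⅓≤m md≤e[l+m] = *-cancelˡ-≤-pos m {{positive (⅓≤⇒0< ⅓≤m)}}
    (≤-trans md≤e[l+m] (≤-by-gap (0≤* 0≤e (+-mono-≤ (0≤* (nonNegative⁻¹ (+ 3 / 1)) (0≤-gap ⅓≤m)) (0≤-gap l≤1)))
      (solve 3 (λ l m e → e :* (con (+ 3 / 1) :* (m :- con ⅓) :+ (con 1ℚ :- l)) := m :* (con (+ 4 / 1) :* e) :- e :* (l :+ m))
             refl l m e)))

  0<suc·1 : ∀ m → 0ℚ < suc m · 1ℚ
  0<suc·1 m = <-≤-trans (positive⁻¹ 1ℚ) (subst (_≤ suc m · 1ℚ) (+-identityʳ 1ℚ) (+-monoʳ-≤ 1ℚ (0≤·1 m)))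
    where
    0≤·1 : ∀ m → 0ℚ ≤ m · 1ℚ
    0≤·1 zero    = ≤-refl
    0≤·1 (suc m) = +-mono-≤ (nonNegative⁻¹ 1ℚ) (0≤·1 m)

  toℚᵘ-·1 : ∀ m → toℚᵘ (m · 1ℚ) ℚᵘ.≃ ℚᵘ.mkℚᵘ (+ m) 0
  toℚᵘ-·1 zero    = ℚᵘ.*≡* refl
  toℚᵘ-·1 (suc m) = ℚᵘ.≃-trans (toℚᵘ-homo-+ 1ℚ (m · 1ℚ))
    (ℚᵘ.≃-trans (ℚᵘ.+-congʳ (toℚᵘ 1ℚ) (toℚᵘ-·1 m)) (ℚᵘ.*≡* (cong (λ z → (+ 1 ℤ.+ z) ℤ.* + 1) (ℤ.*-identityʳ (+ m)))))

  suc·1*1/suc≡1 : ∀ m → (suc m · 1ℚ) * (+ 1 / suc m) ≡ 1ℚ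
  suc·1*1/suc≡1 m = toℚᵘ-injective (ℚᵘ.≃-trans (toℚᵘ-homo-* (suc m · 1ℚ) (+ 1 / suc m))
    (ℚᵘ.≃-trans (ℚᵘ.*-cong (toℚᵘ-·1 (suc m)) (toℚᵘ-fromℚᵘ (ℚᵘ.mkℚᵘ (+ 1) m)))
      (ℚᵘ.*≡* (trans (ℤ.*-identityʳ _) (trans (ℤ.*-identityʳ (+ suc m))
        (sym (trans (ℤ.*-identityˡ _) (cong (λ z → + suc z) (ℕ.+-identityʳ m)))))))))

  sumF≡∑ : ∀ {m} (f : Fin m → ℚ) → sumF f ≡ ∑[ i < m ] f i
  sumF≡∑ {zero}  f = refl
  sumF≡∑ {suc m} f = cong (_+_ (f zero)) (sumF≡∑ (f ∘ suc))

  ∑-linear : ∀ {m} c d (f g : Fin m → ℚ) → ∑[ i < m ] (c * f i + d * g i) ≡ c * ∑[ i < m ] f i + d * ∑[ i < m ] g i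
  ∑-linear c d f g = trans (∑-distrib-+ (λ i → c * f i) (λ i → d * g i)) (sym (cong₂ _+_ (*-distribˡ-sum c f) (*-distribˡ-sum d g)))

  ∑-distrib-- : ∀ {m} (f g : Fin m → ℚ) → ∑[ i < m ] (f i - g i) ≡ ∑[ i < m ] f i - ∑[ i < m ] g i
  ∑-distrib-- {zero}  f g = refl
  ∑-distrib-- {suc m} f g = trans (cong (_+_ (f zero - g zero)) (∑-distrib-- (f ∘ suc) (g ∘ suc)))
    (solve 4 (λ a b c d → (a :- b) :+ (c :- d) := (a :+ c) :- (b :+ d)) refl
       (f zero) (g zero) (∑[ i < m ] f (suc i)) (∑[ i < m ] g (suc i)))

  ∑-mono-≤ : ∀ {m} {f g : Fin m → ℚ} → (∀ i → f i ≤ g i) → ∑[ i < m ] f i ≤ ∑[ i < m ] g i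
  ∑-mono-≤ {zero}  f≤g = ≤-refl
  ∑-mono-≤ {suc m} f≤g = +-mono-≤ (f≤g zero) (∑-mono-≤ (f≤g ∘ suc))

  0≤∑ : ∀ {m} {f : Fin m → ℚ} → (∀ i → 0ℚ ≤ f i) → 0ℚ ≤ ∑[ i < m ] f i
  0≤∑ {zero}  0≤f = ≤-refl
  0≤∑ {suc m} 0≤f = +-mono-≤ (0≤f zero) (0≤∑ (0≤f ∘ suc))

  ∣∑∣≤∑∣∣ : ∀ {m} (f : Fin m → ℚ) → ∣ ∑[ i < m ] f i ∣ ≤ ∑[ i < m ] ∣ f i ∣
  ∣∑∣≤∑∣∣ {zero}  f = ≤-refl
  ∣∑∣≤∑∣∣ {suc m} f = ≤-trans (∣p+q∣≤∣p∣+∣q∣ (f zero) _) (+-monoʳ-≤ ∣ f zero ∣ (∣∑∣≤∑∣∣ (f ∘ suc)))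

  0<∑⇒∃0< : ∀ {m} (f : Fin m → ℚ) → 0ℚ < ∑[ i < m ] f i → ∃ λ i → 0ℚ < f i
  0<∑⇒∃0< {zero}  f 0<0 = ⊥-elim (<-irrefl refl 0<0)
  0<∑⇒∃0< {suc m} f 0<∑ with 0ℚ <? f zero
  ... | yes 0<f₀ = zero , 0<f₀
  ... | no  0≮f₀ with 0<∑⇒∃0< (f ∘ suc) (subst (0ℚ <_) (+-identityˡ _) (<-≤-trans 0<∑ (+-monoˡ-≤ _ (≮⇒≥ 0≮f₀))))
  ...   | i , 0<fᵢ = suc i , 0<fᵢ

  ∑-↑ : ∀ {m n} (f : Fin (m ℕ.+ n) → ℚ) → ∑[ i < m ℕ.+ n ] f i ≡ ∑[ i < m ] f (i ↑ˡ n) + ∑[ i < n ] f (m ↑ʳ i)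
  ∑-↑ {zero}  f = sym (+-identityˡ _)
  ∑-↑ {suc m} {n} f = trans (cong (_+_ (f zero)) (∑-↑ {m} {n} (f ∘ suc))) (sym (+-assoc (f zero) _ _))

  ∑-mono-≤-on-support : ∀ {m} {w f g : Fin m → ℚ} → (∀ i → 0ℚ ≤ w i) → (∀ i → 0ℚ < w i → f i ≤ g i) →
                        ∑[ i < m ] (w i * f i) ≤ ∑[ i < m ] (w i * g i)
  ∑-mono-≤-on-support {w = w} {f} {g} 0≤w f≤g = ∑-mono-≤ wf≤wg
    where
    wf≤wg : ∀ i → w i * f i ≤ w i * g i
    wf≤wg i with 0ℚ <? w i
    ... | yes 0<wᵢ = *-monoˡ-≤-nonNeg (w i) {{nonNegative (0≤w i)}} (f≤g i 0<wᵢ)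
    ... | no  0≮wᵢ rewrite ≤-antisym (≮⇒≥ 0≮wᵢ) (0≤w i) = ≤-reflexive (trans (*-zeroˡ (f i)) (sym (*-zeroˡ (g i))))

  ∑c*w≤∑w : ∀ {m} {c w : Fin m → ℚ} → (∀ i → c i ≤ 1ℚ) → (∀ i → 0ℚ ≤ w i) →
            ∑[ i < m ] (c i * w i) ≤ ∑[ i < m ] w i
  ∑c*w≤∑w {c = c} {w} c≤1 0≤w = ∑-mono-≤ λ i →
    subst (c i * w i ≤_) (*-identityˡ (w i)) (*-monoʳ-≤-nonNeg (w i) {{nonNegative (0≤w i)}} (c≤1 i))

  [∑w]*c≤∑w*f : ∀ {m} {w f : Fin m → ℚ} {c} → (∀ i → 0ℚ ≤ w i) → (∀ i → 0ℚ < w i → c ≤ f i) →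
                (∑[ i < m ] w i) * c ≤ ∑[ i < m ] (w i * f i)
  [∑w]*c≤∑w*f {w = w} {f} {c} 0≤w c≤f =
    subst (_≤ ∑[ i < _ ] (w i * f i)) (sym (*-distribʳ-sum c w)) (∑-mono-≤-on-support 0≤w c≤f)

  ∑∑-swap : ∀ {m n} (u : Fin m → ℚ) (v : Fin n → ℚ) (c : Fin m → Fin n → ℚ) →
            ∑[ i < m ] (u i * ∑[ j < n ] (c i j * v j)) ≡ ∑[ j < n ] (v j * ∑[ i < m ] (c i j * u i))
  ∑∑-swap {m} {n} u v c = begin
    ∑[ i < m ] (u i * ∑[ j < n ] (c i j * v j))
      ≡⟨ sum-cong-≗ (λ i → *-distribˡ-sum (u i) (λ j → c i j * v j)) ⟩
    ∑[ i < m ] ∑[ j < n ] (u i * (c i j * v j))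
      ≡⟨ ∑-comm (λ i j → u i * (c i j * v j)) ⟩
    ∑[ j < n ] ∑[ i < m ] (u i * (c i j * v j))
      ≡⟨ sum-cong-≗ (λ j → sum-cong-≗ (λ i → solve 3 (λ u c v → u :* (c :* v) := v :* (c :* u)) refl (u i) (c i j) (v j))) ⟩
    ∑[ j < n ] ∑[ i < m ] (v j * (c i j * u i))
      ≡⟨ sum-cong-≗ (λ j → sym (*-distribˡ-sum (v j) (λ i → c i j * u i))) ⟩
    ∑[ j < n ] (v j * ∑[ i < m ] (c i j * u i)) ∎
    where open ≡-Reasoning

  χ : ∀ {n} → Subset n → Fin n → ℚ
  χ p i = if lookup p i then 1ℚ else 0ℚ

  χ-∈ : ∀ {n} {p : Subset n} {i} → i ∈ p → χ p i ≡ 1ℚ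
  χ-∈ i∈p = cong (if_then 1ℚ else 0ℚ) (Vec.[]=⇒lookup i∈p)

  χ-∉ : ∀ {n} {p : Subset n} {i} → i ∉ p → χ p i ≡ 0ℚ
  χ-∉ {p = p} {i} i∉p with lookup p i in eq
  ... | true  = ⊥-elim (i∉p (Vec.lookup⇒[]= i p eq))
  ... | false = refl

  0≤χ : ∀ {n} (p : Subset n) i → 0ℚ ≤ χ p i
  0≤χ p i with lookup p i
  ... | true  = nonNegative⁻¹ 1ℚ
  ... | false = ≤-refl

  χ≤1 : ∀ {n} (p : Subset n) i → χ p i ≤ 1ℚ
  χ≤1 p i with lookup p i
  ... | true  = ≤-refl
  ... | false = nonNegative⁻¹ 1ℚ

  0<χ⇒∈ : ∀ {n} {p : Subset n} {i} → 0ℚ < χ p i → i ∈ p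
  0<χ⇒∈ {p = p} {i} 0<χ with i ∈? p
  ... | yes i∈p = i∈p
  ... | no  i∉p = ⊥-elim (<-irrefl (sym (χ-∉ i∉p)) 0<χ)

  ∑χ≡size : ∀ {n} (p : Subset n) → ∑[ i < n ] χ p i ≡ size p · 1ℚ
  ∑χ≡size []            = refl
  ∑χ≡size (inside ∷ p)  = cong (_+_ 1ℚ) (∑χ≡size p)
  ∑χ≡size (outside ∷ p) = trans (+-identityˡ _) (∑χ≡size p)

  χ-─ : ∀ {n} {p q : Subset n} → q ⊆ p → ∀ i → χ q i + χ (p ─ q) i ≡ χ p i
  χ-─ {p = inside  ∷ p} {inside  ∷ q} q⊆p zero    = refl
  χ-─ {p = inside  ∷ p} {outside ∷ q} q⊆p zero    = refl
  χ-─ {p = outside ∷ p} {outside ∷ q} q⊆p zero    = refl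
  χ-─ {p = outside ∷ p} {inside  ∷ q} q⊆p zero    with () ← q⊆p here
  χ-─ {p = x ∷ p}       {inside  ∷ q} q⊆p (suc i) = χ-─ (drop-∷-⊆ q⊆p) i
  χ-─ {p = x ∷ p}       {outside ∷ q} q⊆p (suc i) = χ-─ (drop-∷-⊆ q⊆p) i

  size-─ : ∀ {n} {p q : Subset n} → q ⊆ p → size q ℕ.+ size (p ─ q) ≡ size p
  size-─ {p = []}          {[]}          q⊆p = refl
  size-─ {p = inside  ∷ p} {inside  ∷ q} q⊆p = cong suc (size-─ (drop-∷-⊆ q⊆p))
  size-─ {p = inside  ∷ p} {outside ∷ q} q⊆p = trans (ℕ.+-suc (size q) _) (cong suc (size-─ (drop-∷-⊆ q⊆p)))
  size-─ {p = outside ∷ p} {outside ∷ q} q⊆p = size-─ (drop-∷-⊆ q⊆p)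
  size-─ {p = outside ∷ p} {inside  ∷ q} q⊆p with () ← q⊆p here

  ⊆-of-size : ∀ {n} (p : Subset n) {h} → h ℕ.≤ size p → ∃ λ q → q ⊆ p × size q ≡ h
  ⊆-of-size {n} p        {zero}  _ = ∅ , ⊆-min p , ∣⊥∣≡0 n
  ⊆-of-size (inside ∷ p)  {suc h} (ℕ.s≤s h≤∣p∣) with ⊆-of-size p h≤∣p∣
  ... | q , q⊆p , ∣q∣≡h = inside ∷ q , s⊆s q⊆p , cong suc ∣q∣≡h
  ⊆-of-size (outside ∷ p) {suc h} h<∣p∣ with ⊆-of-size p h<∣p∣
  ... | q , q⊆p , ∣q∣≡h = outside ∷ q , s⊆s q⊆p , ∣q∣≡h

  ∃∈-of-size-suc : ∀ {n} (p : Subset n) {k} → size p ≡ suc k → ∃ λ i → i ∈ p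
  ∃∈-of-size-suc (inside  ∷ p) _         = zero , here
  ∃∈-of-size-suc (outside ∷ p) size-p≡1+k with ∃∈-of-size-suc p size-p≡1+k
  ... | i , i∈p = suc i , there i∈p

  ∈-[]≔⁻ : ∀ {n} {p : Subset n} {j b k} → k ∈ p [ j ]≔ b → k ≡ j ⊎ k ∈ p
  ∈-[]≔⁻ {p = x ∷ p} {zero}  {k = zero}  _             = inj₁ refl
  ∈-[]≔⁻ {p = x ∷ p} {zero}  {k = suc k} (there k∈p)   = inj₂ (there k∈p)
  ∈-[]≔⁻ {p = x ∷ p} {suc j} {k = zero}  here          = inj₂ here
  ∈-[]≔⁻ {p = x ∷ p} {suc j} {k = suc k} (there k∈p[j]) with ∈-[]≔⁻ k∈p[j]
  ... | inj₁ k≡j = inj₁ (cong suc k≡j)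
  ... | inj₂ k∈p = inj₂ (there k∈p)

  size-insert : ∀ {n} {p : Subset n} {i} → i ∉ p → size (p [ i ]≔ inside) ≡ suc (size p)
  size-insert {p = outside ∷ p} {zero}  i∉p = refl
  size-insert {p = inside  ∷ p} {zero}  i∉p = ⊥-elim (i∉p here)
  size-insert {p = inside  ∷ p} {suc i} i∉p = cong suc (size-insert (i∉p ∘ there))
  size-insert {p = outside ∷ p} {suc i} i∉p = size-insert (i∉p ∘ there)

  size-remove : ∀ {n} {p : Subset n} {i} → i ∈ p → suc (size (p [ i ]≔ outside)) ≡ size p
  size-remove {p = inside  ∷ p} here        = refl
  size-remove {p = inside  ∷ p} (there i∈p) = cong suc (size-remove i∈p)
  size-remove {p = outside ∷ p} (there i∈p) = size-remove i∈p

  ∉-[]≔outside : ∀ {n} {p : Subset n} {i i′} → i ∈ p → i′ ∉ p → i′ ∉ p [ i ]≔ outside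
  ∉-[]≔outside i∈p i′∉p i′∈p[i] with ∈-[]≔⁻ i′∈p[i]
  ... | inj₁ refl = i′∉p i∈p
  ... | inj₂ i′∈p = i′∉p i′∈p

  size-swap : ∀ {n} {p : Subset n} {i i′} → i ∈ p → i′ ∉ p → size (p [ i ]≔ outside [ i′ ]≔ inside) ≡ size p
  size-swap i∈p i′∉p = trans (size-insert (∉-[]≔outside i∈p i′∉p)) (size-remove i∈p)

  swap-⊆ : ∀ {n} {p q : Subset n} {i i′} → p ⊆ q → i ∈ p → i′ ∈ q → p [ i ]≔ outside [ i′ ]≔ inside ⊆ q
  swap-⊆ p⊆q i∈p i′∈q k∈swap with ∈-[]≔⁻ k∈swap
  ... | inj₁ refl = i′∈q
  ... | inj₂ k∈p[i] with ∈-[]≔⁻ k∈p[i]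
  ...   | inj₁ refl = p⊆q i∈p
  ...   | inj₂ k∈p  = p⊆q k∈p

  weight : ∀ {n} → (Fin n → ℚ) → Subset n → ℚ
  weight {n} w p = ∑[ i < n ] (χ p i * w i)

  0≤weight : ∀ {n} {w : Fin n → ℚ} → (∀ i → 0ℚ ≤ w i) → ∀ U → 0ℚ ≤ weight w U
  0≤weight 0≤w U = 0≤∑ (λ i → 0≤* (0≤χ U i) (0≤w i))

  weight≤∑ : ∀ {n} {w : Fin n → ℚ} → (∀ i → 0ℚ ≤ w i) → ∀ U → weight w U ≤ ∑[ i < n ] w i
  weight≤∑ 0≤w U = ∑c*w≤∑w (χ≤1 U) 0≤w

  weight-[]≔ : ∀ {n} (w : Fin n → ℚ) (p : Subset n) i b →
               weight w (p [ i ]≔ b) + χ p i * w i ≡ weight w p + (if b then 1ℚ else 0ℚ) * w i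
  weight-[]≔ w (x ∷ p) zero    b =
    solve 3 (λ new rest old → new :+ rest :+ old := old :+ rest :+ new) refl
      (χ (b ∷ p) zero * w zero) (weight (w ∘ suc) p) (χ (x ∷ p) zero * w zero)
  weight-[]≔ w (x ∷ p) (suc i) b = begin
    χ (x ∷ p) zero * w zero + W′ + c     ≡⟨ +-assoc (χ (x ∷ p) zero * w zero) W′ c ⟩
    χ (x ∷ p) zero * w zero + (W′ + c)   ≡⟨ cong (_+_ (χ (x ∷ p) zero * w zero)) (weight-[]≔ (w ∘ suc) p i b) ⟩
    χ (x ∷ p) zero * w zero + (W + c′)   ≡⟨ sym (+-assoc (χ (x ∷ p) zero * w zero) W c′) ⟩
    χ (x ∷ p) zero * w zero + W + c′     ∎
    where
    open ≡-Reasoning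
    W′ W c c′ : ℚ
    W′ = weight (w ∘ suc) (p [ i ]≔ b)
    W  = weight (w ∘ suc) p
    c  = χ p i * w (suc i)
    c′ = (if b then 1ℚ else 0ℚ) * w (suc i)

  weight-swap : ∀ {n} (w : Fin n → ℚ) {p : Subset n} {i i′} → i ∈ p → i′ ∉ p →
                weight w (p [ i ]≔ outside [ i′ ]≔ inside) + w i ≡ weight w p + w i′
  weight-swap w {p} {i} {i′} i∈p i′∉p = begin
    W″ + w i                  ≡⟨ solve 3 (λ W″ x y → W″ :+ y := W″ :+ con 0ℚ :* x :+ y) refl W″ (w i′) (w i) ⟩
    W″ + 0ℚ * w i′ + w i      ≡⟨ cong (λ c → W″ + c * w i′ + w i) (sym (χ-∉ i′∉p′)) ⟩
    W″ + χ p′ i′ * w i′ + w i ≡⟨ cong (_+ w i) (weight-[]≔ w p′ i′ inside) ⟩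
    W′ + 1ℚ * w i′ + w i      ≡⟨ solve 3 (λ W′ x y → W′ :+ con 1ℚ :* x :+ y := W′ :+ con 1ℚ :* y :+ x) refl W′ (w i′) (w i) ⟩
    W′ + 1ℚ * w i + w i′      ≡⟨ cong (λ c → W′ + c * w i + w i′) (sym (χ-∈ i∈p)) ⟩
    W′ + χ p i * w i + w i′   ≡⟨ cong (_+ w i′) (weight-[]≔ w p i outside) ⟩
    W + 0ℚ * w i + w i′       ≡⟨ solve 3 (λ W x y → W :+ con 0ℚ :* x :+ y := W :+ y) refl W (w i) (w i′) ⟩
    W + w i′                  ∎
    where
    open ≡-Reasoning
    p′ : Subset _
    p′ = p [ i ]≔ outside
    W W′ W″ : ℚ
    W = weight w p
    W′ = weight w p′
    W″ = weight w (p′ [ i′ ]≔ inside)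
    i′∉p′ : i′ ∉ p′
    i′∉p′ = ∉-[]≔outside i∈p i′∉p

  off-support : ∀ {n} {v : Fin n → ℚ} {S : Subset n} → SuppIn v S → ∀ {i} → i ∉ S → v i ≡ 0ℚ
  off-support {v = v} v⊆S {i} i∉S with v i ≟ 0ℚ
  ... | yes vᵢ≡0 = vᵢ≡0
  ... | no  vᵢ≢0 = ⊥-elim (i∉S (v⊆S i vᵢ≢0))

  χ*w≡w : ∀ {n} {S : Subset n} {w : Fin n → ℚ} → (∀ {i} → i ∉ S → w i ≡ 0ℚ) → ∀ i → χ S i * w i ≡ w i
  χ*w≡w {S = S} {w} w-off-S i with i ∈? S
  ... | yes i∈S = trans (cong (_* w i) (χ-∈ i∈S)) (*-identityˡ (w i))
  ... | no  i∉S = trans (cong (_* w i) (χ-∉ i∉S)) (trans (*-zeroˡ (w i)) (sym (w-off-S i∉S)))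

  *-congˡ-on-support : ∀ {n} {v f g : Fin n → ℚ} {S : Subset n} → (∀ {i} → i ∉ S → v i ≡ 0ℚ) →
                       (∀ {i} → i ∈ S → f i ≡ g i) → ∀ i → v i * f i ≡ v i * g i
  *-congˡ-on-support {v = v} {f} {g} {S} v-off-S f≡g i with i ∈? S
  ... | yes i∈S = cong (v i *_) (f≡g i∈S)
  ... | no  i∉S = trans (cong (_* f i) (v-off-S i∉S))
                    (trans (*-zeroˡ (f i)) (sym (trans (cong (_* g i) (v-off-S i∉S)) (*-zeroˡ (g i)))))

  mean-≤ : ∀ {n} (S : Subset n) {g : Fin n → ℚ} {m} → 0ℚ < ∑[ k < n ] χ S k →
           ∑[ k < n ] (χ S k * g k) ≡ (∑[ k < n ] χ S k) * m →
           ∀ {M c z} → (∀ {k} → k ∈ S → M * (g k + c) ≤ z) → M * (m + c) ≤ z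
  mean-≤ {n} S {g} {m} 0<N ∑χg≡Nm {M} {c} {z} bound = *-cancelˡ-≤-pos N {{positive 0<N}} (begin
    N * (M * (m + c))
      ≡⟨ solve 4 (λ N M m c → N :* (M :* (m :+ c)) := M :* (N :* m) :+ M :* c :* N) refl N M m c ⟩
    M * (N * m) + M * c * N
      ≡⟨ cong (λ s → M * s + M * c * N) (sym ∑χg≡Nm) ⟩
    M * ∑[ k < n ] (χ S k * g k) + M * c * N
      ≡⟨ sym (∑-linear M (M * c) (λ k → χ S k * g k) (χ S)) ⟩
    ∑[ k < n ] (M * (χ S k * g k) + M * c * χ S k)
      ≡⟨ sum-cong-≗ (λ k → solve 4 (λ M x g c → M :* (x :* g) :+ M :* c :* x := x :* (M :* (g :+ c))) refl M (χ S k) (g k) c) ⟩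
    ∑[ k < n ] (χ S k * (M * (g k + c)))
      ≤⟨ ∑-mono-≤-on-support (0≤χ S) (λ k 0<χ → bound (0<χ⇒∈ 0<χ)) ⟩
    ∑[ k < n ] (χ S k * z)
      ≡⟨ sym (*-distribʳ-sum z (χ S)) ⟩
    N * z ∎)
    where
    open ≤-Reasoning
    N : ℚ
    N = ∑[ k < n ] χ S k

  -- Balanced weights are nearly uniform

  threshold-deviation : ∀ {n} {U V : Subset n} (w : Fin n → ℚ) c →
    (∀ {i} → i ∈ U → i ∉ V) → (∀ {i} → i ∈ U → c ≤ w i) → (∀ {i} → i ∈ V → w i ≤ c) → size U ≡ size V →
    ∑[ i < n ] ((χ U i + χ V i) * ∣ w i - c ∣) + weight w V ≡ weight w U
  threshold-deviation {n} {U} {V} w c U∩V≡∅ c≤w w≤c ∣U∣≡∣V∣ = +-cancelʳ (c * ∑[ i < n ] χ U i) _ _ (begin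
    ∑[ i < n ] D i + weight w V + c * ∑[ i < n ] χ U i
      ≡⟨ cong₂ _+_ (sym (∑-distrib-+ D (λ i → χ V i * w i))) (*-distribˡ-sum c (χ U)) ⟩
    ∑[ i < n ] (D i + χ V i * w i) + ∑[ i < n ] (c * χ U i)
      ≡⟨ sym (∑-distrib-+ (λ i → D i + χ V i * w i) (λ i → c * χ U i)) ⟩
    ∑[ i < n ] (D i + χ V i * w i + c * χ U i)
      ≡⟨ sum-cong-≗ pointwise ⟩
    ∑[ i < n ] (χ U i * w i + c * χ V i)
      ≡⟨ ∑-distrib-+ (λ i → χ U i * w i) (λ i → c * χ V i) ⟩
    weight w U + ∑[ i < n ] (c * χ V i)
      ≡⟨ cong (_+_ (weight w U)) (sym (*-distribˡ-sum c (χ V))) ⟩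
    weight w U + c * ∑[ i < n ] χ V i
      ≡⟨ cong (λ N → weight w U + c * N) (trans (∑χ≡size V) (cong (_· 1ℚ) (sym ∣U∣≡∣V∣))) ⟩
    weight w U + c * (size U · 1ℚ)
      ≡⟨ cong (λ N → weight w U + c * N) (sym (∑χ≡size U)) ⟩
    weight w U + c * ∑[ i < n ] χ U i ∎)
    where
    open ≡-Reasoning
    D : Fin n → ℚ
    D i = (χ U i + χ V i) * ∣ w i - c ∣
    pointwise : ∀ i → (χ U i + χ V i) * ∣ w i - c ∣ + χ V i * w i + c * χ U i ≡ χ U i * w i + c * χ V i
    pointwise i with i ∈? U | i ∈? V
    ... | yes i∈U | yes i∈V = ⊥-elim (U∩V≡∅ i∈U i∈V)
    ... | yes i∈U | no  i∉V rewrite χ-∈ i∈U | χ-∉ i∉V | 0≤p⇒∣p∣≡p (0≤-gap (c≤w i∈U)) =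
      solve 2 (λ x c → (con 1ℚ :+ con 0ℚ) :* (x :- c) :+ con 0ℚ :* x :+ c :* con 1ℚ := con 1ℚ :* x :+ c :* con 0ℚ) refl (w i) c
    ... | no  i∉U | yes i∈V rewrite χ-∉ i∉U | χ-∈ i∈V =
      trans (cong (λ d → (0ℚ + 1ℚ) * d + 1ℚ * w i + c * 0ℚ) (p≤q⇒∣p-q∣≡q-p (w≤c i∈V)))
        (solve 2 (λ x c → (con 0ℚ :+ con 1ℚ) :* (c :- x) :+ con 1ℚ :* x :+ c :* con 0ℚ := con 0ℚ :* x :+ c :* con 1ℚ) refl (w i) c)
    ... | no  i∉U | no  i∉V rewrite χ-∉ i∉U | χ-∉ i∉V =
      solve 3 (λ d x c → (con 0ℚ :+ con 0ℚ) :* d :+ con 0ℚ :* x :+ c :* con 0ℚ := con 0ℚ :* x :+ c :* con 0ℚ) refl ∣ w i - c ∣ (w i) c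

  ∣∑χ*c-∑w∣≤ : ∀ {n} (S : Subset n) {w : Fin n → ℚ} → (∀ {i} → i ∉ S → w i ≡ 0ℚ) → ∀ c →
               ∣ (∑[ i < n ] χ S i) * c - ∑[ i < n ] w i ∣ ≤ ∑[ i < n ] (χ S i * ∣ w i - c ∣)
  ∣∑χ*c-∑w∣≤ {n} S {w} w-off-S c = begin
    ∣ (∑[ i < n ] χ S i) * c - ∑[ i < n ] w i ∣
      ≡⟨ cong ∣_∣ (cong₂ _-_ (*-distribʳ-sum c (χ S)) (sum-cong-≗ (sym ∘ χ*w≡w w-off-S))) ⟩
    ∣ ∑[ i < n ] (χ S i * c) - ∑[ i < n ] (χ S i * w i) ∣
      ≡⟨ cong ∣_∣ (sym (∑-distrib-- (λ i → χ S i * c) (λ i → χ S i * w i))) ⟩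
    ∣ ∑[ i < n ] (χ S i * c - χ S i * w i) ∣
      ≤⟨ ∣∑∣≤∑∣∣ (λ i → χ S i * c - χ S i * w i) ⟩
    ∑[ i < n ] ∣ χ S i * c - χ S i * w i ∣
      ≡⟨ sum-cong-≗ ∣χc-χw∣≡χ∣w-c∣ ⟩
    ∑[ i < n ] (χ S i * ∣ w i - c ∣) ∎
    where
    open ≤-Reasoning
    ∣χc-χw∣≡χ∣w-c∣ : ∀ i → ∣ χ S i * c - χ S i * w i ∣ ≡ χ S i * ∣ w i - c ∣
    ∣χc-χw∣≡χ∣w-c∣ i = begin-equality
      ∣ χ S i * c - χ S i * w i ∣   ≡⟨ cong ∣_∣ (solve 3 (λ x c w → x :* c :- x :* w := x :* (c :- w)) refl (χ S i) c (w i)) ⟩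
      ∣ χ S i * (c - w i) ∣         ≡⟨ ∣p*q∣≡∣p∣*∣q∣ (χ S i) (c - w i) ⟩
      ∣ χ S i ∣ * ∣ c - w i ∣       ≡⟨ cong₂ _*_ (0≤p⇒∣p∣≡p (0≤χ S i)) (∣p-q∣≡∣q-p∣ c (w i)) ⟩
      χ S i * ∣ w i - c ∣           ∎

  ∑∣w-χu∣≤ : ∀ {n} (S : Subset n) {w : Fin n → ℚ} → (∀ {i} → i ∉ S → w i ≡ 0ℚ) → ∀ c u →
             ∑[ i < n ] ∣ w i - χ S i * u ∣ ≤
             ∑[ i < n ] (χ S i * ∣ w i - c ∣) + ∑[ i < n ] (χ S i * ∣ w i - c ∣) + ∣ ∑[ i < n ] w i - (∑[ i < n ] χ S i) * u ∣
  ∑∣w-χu∣≤ {n} S {w} w-off-S c u = begin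
    ∑[ i < n ] ∣ w i - χ S i * u ∣
      ≤⟨ ∑-mono-≤ pointwise ⟩
    ∑[ i < n ] (χ S i * ∣ w i - c ∣ + χ S i * ∣ c - u ∣)
      ≡⟨ ∑-distrib-+ (λ i → χ S i * ∣ w i - c ∣) (λ i → χ S i * ∣ c - u ∣) ⟩
    D + ∑[ i < n ] (χ S i * ∣ c - u ∣)
      ≡⟨ cong (_+_ D) (sym (*-distribʳ-sum ∣ c - u ∣ (χ S))) ⟩
    D + N * ∣ c - u ∣
      ≡⟨ cong (_+_ D) N∣c-u∣≡ ⟩
    D + ∣ (N * c - ∑[ i < n ] w i) + (∑[ i < n ] w i - N * u) ∣
      ≤⟨ +-monoʳ-≤ D (∣p+q∣≤∣p∣+∣q∣ (N * c - ∑[ i < n ] w i) (∑[ i < n ] w i - N * u)) ⟩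
    D + (∣ N * c - ∑[ i < n ] w i ∣ + ∣ ∑[ i < n ] w i - N * u ∣)
      ≤⟨ +-monoʳ-≤ D (+-monoˡ-≤ ∣ ∑[ i < n ] w i - N * u ∣ (∣∑χ*c-∑w∣≤ S w-off-S c)) ⟩
    D + (D + ∣ ∑[ i < n ] w i - N * u ∣)
      ≡⟨ sym (+-assoc D D ∣ ∑[ i < n ] w i - N * u ∣) ⟩
    D + D + ∣ ∑[ i < n ] w i - N * u ∣ ∎
    where
    open ≤-Reasoning
    D N : ℚ
    D = ∑[ i < n ] (χ S i * ∣ w i - c ∣)
    N = ∑[ i < n ] χ S i
    N∣c-u∣≡ : N * ∣ c - u ∣ ≡ ∣ (N * c - ∑[ i < n ] w i) + (∑[ i < n ] w i - N * u) ∣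
    N∣c-u∣≡ = begin-equality
      N * ∣ c - u ∣       ≡⟨ cong (_* ∣ c - u ∣) (sym (0≤p⇒∣p∣≡p (0≤∑ (0≤χ S)))) ⟩
      ∣ N ∣ * ∣ c - u ∣   ≡⟨ sym (∣p*q∣≡∣p∣*∣q∣ N (c - u)) ⟩
      ∣ N * (c - u) ∣     ≡⟨ cong ∣_∣ (solve 4 (λ N c u W → N :* (c :- u) := (N :* c :- W) :+ (W :- N :* u)) refl N c u (∑[ i < n ] w i)) ⟩
      ∣ (N * c - ∑[ i < n ] w i) + (∑[ i < n ] w i - N * u) ∣ ∎
    pointwise : ∀ i → ∣ w i - χ S i * u ∣ ≤ χ S i * ∣ w i - c ∣ + χ S i * ∣ c - u ∣
    pointwise i with i ∈? S
    ... | yes i∈S = begin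
      ∣ w i - χ S i * u ∣                       ≡⟨ cong (λ x → ∣ w i - x * u ∣) (χ-∈ i∈S) ⟩
      ∣ w i - 1ℚ * u ∣                          ≡⟨ cong ∣_∣ (solve 3 (λ w c u → w :- con 1ℚ :* u := (w :- c) :+ (c :- u)) refl (w i) c u) ⟩
      ∣ (w i - c) + (c - u) ∣                   ≤⟨ ∣p+q∣≤∣p∣+∣q∣ (w i - c) (c - u) ⟩
      ∣ w i - c ∣ + ∣ c - u ∣                   ≡⟨ sym (cong₂ _+_ (*-identityˡ ∣ w i - c ∣) (*-identityˡ ∣ c - u ∣)) ⟩
      1ℚ * ∣ w i - c ∣ + 1ℚ * ∣ c - u ∣         ≡⟨ cong (λ x → x * ∣ w i - c ∣ + x * ∣ c - u ∣) (sym (χ-∈ i∈S)) ⟩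
      χ S i * ∣ w i - c ∣ + χ S i * ∣ c - u ∣   ∎
    ... | no  i∉S = begin
      ∣ w i - χ S i * u ∣                       ≡⟨ cong₂ (λ x y → ∣ x - y * u ∣) (w-off-S i∉S) (χ-∉ i∉S) ⟩
      ∣ 0ℚ - 0ℚ * u ∣                           ≡⟨ cong ∣_∣ (solve 1 (λ u → con 0ℚ :- con 0ℚ :* u := con 0ℚ) refl u) ⟩
      0ℚ                                         ≤⟨ +-mono-≤ (0≤* (0≤χ S i) (0≤∣p∣ _)) (0≤* (0≤χ S i) (0≤∣p∣ _)) ⟩
      χ S i * ∣ w i - c ∣ + χ S i * ∣ c - u ∣   ∎

  module _ {n m k : ℕ} (S : Subset n) (T : Fin m → Subset n)
           (size-S : size S ≡ suc k ℕ.+ suc k) (T⊆S : ∀ j → T j ⊆ S) (size-T : ∀ j → size (T j) ≡ suc k)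
           (T-onto : ∀ U → U ⊆ S → size U ≡ suc k → ∃ λ j → T j ≡ U) where

    some-index : Fin m
    some-index with ⊆-of-size S (subst (suc k ℕ.≤_) (sym size-S) (ℕ.m≤m+n (suc k) (suc k)))
    ... | U , U⊆S , size-U = proj₁ (T-onto U U⊆S size-U)

    size-S─T : ∀ j → size (S ─ T j) ≡ suc k
    size-S─T j = ℕ.+-cancelˡ-≡ (suc k) _ _
      (trans (cong (ℕ._+ size (S ─ T j)) (sym (size-T j))) (trans (size-─ (T⊆S j)) size-S))

    complement : ∀ j → ∃ λ j′ → ∀ i → χ (T j) i + χ (T j′) i ≡ χ S i
    complement j with T-onto (S ─ T j) (p─q⊆p S (T j)) (size-S─T j)
    ... | j′ , Tj′≡S─Tj = j′ , λ i → trans (cong (λ U → χ (T j) i + χ U i) Tj′≡S─Tj) (χ-─ (T⊆S j) i)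

    complement-disjoint : ∀ {U V : Subset n} → (∀ i → χ U i + χ V i ≡ χ S i) → ∀ {i} → i ∈ U → i ∉ V
    complement-disjoint {U} {V} χU+χV≡χS {i} i∈U i∈V = <-irrefl refl (<-≤-trans 1<2 (begin
      1ℚ + 1ℚ          ≡⟨ sym (cong₂ _+_ (χ-∈ i∈U) (χ-∈ i∈V)) ⟩
      χ U i + χ V i    ≡⟨ χU+χV≡χS i ⟩
      χ S i            ≤⟨ χ≤1 S i ⟩
      1ℚ               ∎))
      where
      open ≤-Reasoning
      1<2 : 1ℚ < 1ℚ + 1ℚ
      1<2 = toWitness {a? = 1ℚ <? 1ℚ + 1ℚ} _

    module _ (w : Fin n → ℚ) (w-off-S : ∀ {i} → i ∉ S → w i ≡ 0ℚ) where

      heaviest : Fin m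
      heaviest = argmax (weight w ∘ T) some-index (allFin m)

      heaviest-max : ∀ j → weight w (T j) ≤ weight w (T heaviest)
      heaviest-max j = All.lookup (f[xs]≤f[argmax] {f = weight w ∘ T} some-index (allFin m)) (∈-allFin j)

      exchange : ∀ {i i′} → i ∈ T heaviest → i′ ∈ S → i′ ∉ T heaviest → w i′ ≤ w i
      exchange {i} {i′} i∈U i′∈S i′∉U
        with T-onto (T heaviest [ i ]≔ outside [ i′ ]≔ inside) (swap-⊆ (T⊆S heaviest) i∈U i′∈S)
                    (trans (size-swap i∈U i′∉U) (size-T heaviest))
      ... | j , Tj≡swap = +≡+⇒≤ (subst (λ U → weight w U ≤ weight w (T heaviest)) Tj≡swap (heaviest-max j))
                                (weight-swap w i∈U i′∉U)

      weight-complement : ∀ {U V : Subset n} → (∀ i → χ U i + χ V i ≡ χ S i) → weight w U + weight w V ≡ ∑[ i < n ] w i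
      weight-complement {U} {V} χU+χV≡χS = begin
        weight w U + weight w V
          ≡⟨ sym (∑-distrib-+ (λ i → χ U i * w i) (λ i → χ V i * w i)) ⟩
        ∑[ i < n ] (χ U i * w i + χ V i * w i)
          ≡⟨ sum-cong-≗ (λ i → trans (sym (*-distribʳ-+ (w i) (χ U i) (χ V i))) (cong (_* w i) (χU+χV≡χS i))) ⟩
        ∑[ i < n ] (χ S i * w i)
          ≡⟨ sum-cong-≗ (χ*w≡w w-off-S) ⟩
        ∑[ i < n ] w i ∎
        where open ≡-Reasoning

      lighter-half : ∃ λ j → weight w (T j) + weight w (T j) ≤ ∑[ i < n ] w i
      lighter-half with complement some-index
      ... | j′ , χ+χ′≡χS = lighter (≤-total (W some-index) (W j′))
        where
        W : Fin m → ℚ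
        W j = weight w (T j)
        W+W′≡∑w : W some-index + W j′ ≡ ∑[ i < n ] w i
        W+W′≡∑w = weight-complement {T some-index} {T j′} χ+χ′≡χS
        lighter : W some-index ≤ W j′ ⊎ W j′ ≤ W some-index → ∃ λ j → W j + W j ≤ ∑[ i < n ] w i
        lighter (inj₁ W≤W′) = some-index , subst (W some-index + W some-index ≤_) W+W′≡∑w (+-monoʳ-≤ (W some-index) W≤W′)
        lighter (inj₂ W′≤W) = j′ , subst (W j′ + W j′ ≤_) (trans (+-comm (W j′) (W some-index)) W+W′≡∑w) (+-monoʳ-≤ (W j′) W′≤W)

      U V : Subset n
      U = T heaviest
      V = T (proj₁ (complement heaviest))

      χU+χV≡χS : ∀ i → χ U i + χ V i ≡ χ S i
      χU+χV≡χS = proj₂ (complement heaviest)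

      -- By exchange, the least weight c on the heaviest T j bounds the weights on its
      -- complement, so Σ χ_S |w - c| is the difference of the weights of the two halves.
      pivot : Fin n
      pivot = argmin w (proj₁ (∃∈-of-size-suc U (size-T heaviest))) (filter (_∈? U) (allFin n))

      pivot∈U : pivot ∈ U
      pivot∈U = argmin-all w (proj₂ (∃∈-of-size-suc U (size-T heaviest))) (all-filter (_∈? U) (allFin n))

      pivot-min : ∀ {i} → i ∈ U → w pivot ≤ w i
      pivot-min {i} i∈U = All.lookup (f[argmin]≤f[xs] {f = w} (proj₁ (∃∈-of-size-suc U (size-T heaviest))) (filter (_∈? U) (allFin n)))
                                     (∈-filter⁺ (_∈? U) (∈-allFin i) i∈U)

      deviation≡ : ∑[ i < n ] (χ S i * ∣ w i - w pivot ∣) ≡ ∑[ i < n ] w i - (weight w V + weight w V)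
      deviation≡ = begin
        ∑[ i < n ] (χ S i * ∣ w i - w pivot ∣)
          ≡⟨ sum-cong-≗ (λ i → cong (_* ∣ w i - w pivot ∣) (sym (χU+χV≡χS i))) ⟩
        D
          ≡⟨ solve 2 (λ D V → D := (D :+ V) :- V) refl D (weight w V) ⟩
        (D + weight w V) - weight w V
          ≡⟨ cong (_- weight w V) threshold ⟩
        weight w U - weight w V
          ≡⟨ solve 2 (λ U V → U :- V := (U :+ V) :- (V :+ V)) refl (weight w U) (weight w V) ⟩
        (weight w U + weight w V) - (weight w V + weight w V)
          ≡⟨ cong (_- (weight w V + weight w V)) (weight-complement {U} {V} χU+χV≡χS) ⟩
        ∑[ i < n ] w i - (weight w V + weight w V) ∎
        where
        open ≡-Reasoning
        D : ℚ
        D = ∑[ i < n ] ((χ U i + χ V i) * ∣ w i - w pivot ∣)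
        threshold : D + weight w V ≡ weight w U
        threshold = threshold-deviation w (w pivot) (complement-disjoint {U} {V} χU+χV≡χS) pivot-min
          (λ i∈V → exchange pivot∈U (T⊆S _ i∈V) (λ i∈U → complement-disjoint {U} {V} χU+χV≡χS i∈U i∈V))
          (trans (size-T heaviest) (sym (size-T _)))

      concentration : ∀ δ → (∀ j → ∑[ i < n ] w i * ½ - δ ≤ weight w (T j)) → ∀ u →
                      ∑[ i < n ] ∣ w i - χ S i * u ∣ ≤ + 4 / 1 * δ + ∣ ∑[ i < n ] w i - (∑[ i < n ] χ S i) * u ∣
      concentration δ balanced u = begin
        ∑[ i < n ] ∣ w i - χ S i * u ∣  ≤⟨ ∑∣w-χu∣≤ S w-off-S (w pivot) u ⟩
        D + D + E                      ≤⟨ +-monoˡ-≤ E D+D≤4δ ⟩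
        + 4 / 1 * δ + E                ∎
        where
        open ≤-Reasoning
        D W wV E : ℚ
        D = ∑[ i < n ] (χ S i * ∣ w i - w pivot ∣)
        W = ∑[ i < n ] w i
        wV = weight w V
        E = ∣ ∑[ i < n ] w i - (∑[ i < n ] χ S i) * u ∣
        D+D≤4δ : D + D ≤ + 4 / 1 * δ
        D+D≤4δ = subst (λ d → d + d ≤ + 4 / 1 * δ) (sym deviation≡)
          (≤-by-gap (0≤* (nonNegative⁻¹ (+ 4 / 1)) (0≤-gap (balanced _)))
            (solve 3 (λ wV W δ → con (+ 4 / 1) :* (wV :- (W :* con ½ :- δ))
                                 := con (+ 4 / 1) :* δ :- ((W :- (wV :+ wV)) :+ (W :- (wV :+ wV)))) refl wV W δ))

  -- The game (R_S, C_S)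

  halfUniform≡χ* : ∀ {n} l .{{_ : ℕ.NonZero l}} (S : Subset n) i → halfUniform l S i ≡ χ S i * ((+ 1 / l) * ½)
  halfUniform≡χ* l S i with i ∈? S
  ... | yes i∈S = trans (sym (*-identityˡ ((+ 1 / l) * ½))) (cong (_* ((+ 1 / l) * ½)) (sym (χ-∈ i∈S)))
  ... | no  i∉S = trans (sym (*-zeroˡ ((+ 1 / l) * ½))) (cong (_* ((+ 1 / l) * ½)) (sym (χ-∉ i∉S)))

  A-mat≡ : ∀ {n} {S : Subset n} {T : Fin n → Subset n} → (∀ j → T j ⊆ S) → ∀ i j → A-mat S T i j ≡ χ (T j) i + χ S i - 1ℚ
  A-mat≡ {S = S} {T} T⊆S i j with i ∈? S | i ∈? T j
  ... | no  i∉S | _ rewrite χ-∉ i∉S | χ-∉ (i∉S ∘ T⊆S j) = refl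
  ... | yes i∈S | yes i∈Tj rewrite χ-∈ i∈S | χ-∈ i∈Tj = refl
  ... | yes i∈S | no  i∉Tj rewrite χ-∈ i∈S | χ-∉ i∉Tj = refl

  B-mat≡ : ∀ {n} {S : Subset n} {T : Fin n → Subset n} → (∀ j → T j ⊆ S) → ∀ i j → B-mat S T i j ≡ 1ℚ - χ (T j) i
  B-mat≡ {S = S} {T} T⊆S i j with i ∈? S | i ∈? T j
  ... | no  i∉S | _ rewrite χ-∉ (i∉S ∘ T⊆S j) = refl
  ... | yes i∈S | yes i∈Tj rewrite χ-∈ i∈Tj = refl
  ... | yes i∈S | no  i∉Tj rewrite χ-∉ i∉Tj = refl

  module _ {n} (S : Subset n) (T : Fin n → Subset n) (i j : Fin n) where

    R-mat-↑ˡ↑ˡ : R-mat S T (i ↑ˡ n) (j ↑ˡ n) ≡ two + A-mat S T i j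
    R-mat-↑ˡ↑ˡ rewrite splitAt-↑ˡ n i n | splitAt-↑ˡ n j n = refl
    R-mat-↑ˡ↑ʳ : R-mat S T (i ↑ˡ n) (n ↑ʳ j) ≡ - two
    R-mat-↑ˡ↑ʳ rewrite splitAt-↑ˡ n i n | splitAt-↑ʳ n n j = refl
    R-mat-↑ʳ↑ˡ : R-mat S T (n ↑ʳ i) (j ↑ˡ n) ≡ - two
    R-mat-↑ʳ↑ˡ rewrite splitAt-↑ʳ n n i | splitAt-↑ˡ n j n = refl
    R-mat-↑ʳ↑ʳ : R-mat S T (n ↑ʳ i) (n ↑ʳ j) ≡ two + B-mat S T j i
    R-mat-↑ʳ↑ʳ rewrite splitAt-↑ʳ n n i | splitAt-↑ʳ n n j = refl
    C-mat-↑ˡ↑ˡ : C-mat S T (i ↑ˡ n) (j ↑ˡ n) ≡ - two + B-mat S T i j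
    C-mat-↑ˡ↑ˡ rewrite splitAt-↑ˡ n i n | splitAt-↑ˡ n j n = refl
    C-mat-↑ˡ↑ʳ : C-mat S T (i ↑ˡ n) (n ↑ʳ j) ≡ two
    C-mat-↑ˡ↑ʳ rewrite splitAt-↑ˡ n i n | splitAt-↑ʳ n n j = refl
    C-mat-↑ʳ↑ˡ : C-mat S T (n ↑ʳ i) (j ↑ˡ n) ≡ two
    C-mat-↑ʳ↑ˡ rewrite splitAt-↑ʳ n n i | splitAt-↑ˡ n j n = refl
    C-mat-↑ʳ↑ʳ : C-mat S T (n ↑ʳ i) (n ↑ʳ j) ≡ - two + A-mat S T j i
    C-mat-↑ʳ↑ʳ rewrite splitAt-↑ʳ n n i | splitAt-↑ʳ n n j = refl

  rowPayoff-split : ∀ {n} (M : Matrix (n ℕ.+ n) (n ℕ.+ n)) y r →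
    rowPayoff M y r ≡ ∑[ j < n ] (M r (j ↑ˡ n) * left y j) + ∑[ j < n ] (M r (n ↑ʳ j) * right y j)
  rowPayoff-split {n} M y r = trans (sumF≡∑ (λ j → M r j * y j)) (∑-↑ {n} {n} (λ j → M r j * y j))

  colPayoff-split : ∀ {n} (M : Matrix (n ℕ.+ n) (n ℕ.+ n)) x c →
    colPayoff M x c ≡ ∑[ i < n ] (left x i * M (i ↑ˡ n) c) + ∑[ i < n ] (right x i * M (n ↑ʳ i) c)
  colPayoff-split {n} M x c = trans (sumF≡∑ (λ i → x i * M i c)) (∑-↑ {n} {n} (λ i → x i * M i c))

  ∑-right≡1-∑-left : ∀ {n} {x : Fin (n ℕ.+ n) → ℚ} → IsMixed x → ∑[ i < n ] right x i ≡ 1ℚ - ∑[ i < n ] left x i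
  ∑-right≡1-∑-left {n} {x} (_ , ∑x≡1) = begin
    R               ≡⟨ solve 2 (λ L R → R := (L :+ R) :- L) refl L R ⟩
    (L + R) - L     ≡⟨ cong (_- L) (trans (sym (∑-↑ {n} {n} x)) (trans (sym (sumF≡∑ x)) ∑x≡1)) ⟩
    1ℚ - L          ∎
    where
    open ≡-Reasoning
    L R : ℚ
    L = ∑[ i < n ] left x i
    R = ∑[ i < n ] right x i

  module _ {n k : ℕ} {S : Subset n} {T : Fin n → Subset n}
           (size-S : size S ≡ suc k ℕ.+ suc k) (T⊆S : ∀ j → T j ⊆ S) (size-T : ∀ j → size (T j) ≡ suc k)
           (T-onto : ∀ U → U ⊆ S → size U ≡ suc k → ∃ λ j → T j ≡ U)
           {ε : ℚ} (0≤ε : 0ℚ ≤ ε) (ε<⅓ : ε < ⅓)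
           {x y : Fin (n ℕ.+ n) → ℚ} (wne : IsWNE ε (R-mat S T) (C-mat S T) x y) where

    xˡ xʳ yˡ yʳ : Fin n → ℚ
    xˡ = left x
    xʳ = right x
    yˡ = left y
    yʳ = right y

    a b : ℚ
    a = ∑[ i < n ] xˡ i
    b = ∑[ i < n ] yˡ i

    ∑-right-x : ∑[ i < n ] xʳ i ≡ 1ℚ - a
    ∑-right-x = ∑-right≡1-∑-left {n} (proj₁ wne)

    ∑-right-y : ∑[ i < n ] yʳ i ≡ 1ℚ - b
    ∑-right-y = ∑-right≡1-∑-left {n} (proj₁ (proj₂ wne))

    0≤xˡ : ∀ i → 0ℚ ≤ xˡ i
    0≤xˡ i = proj₁ (proj₁ (proj₁ wne) (i ↑ˡ n))

    0≤xʳ : ∀ i → 0ℚ ≤ xʳ i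
    0≤xʳ i = proj₁ (proj₁ (proj₁ wne) (n ↑ʳ i))

    0≤yˡ : ∀ i → 0ℚ ≤ yˡ i
    0≤yˡ i = proj₁ (proj₁ (proj₁ (proj₂ wne)) (i ↑ˡ n))

    0≤yʳ : ∀ i → 0ℚ ≤ yʳ i
    0≤yʳ i = proj₁ (proj₁ (proj₁ (proj₂ wne)) (n ↑ʳ i))

    0≤a : 0ℚ ≤ a
    0≤a = 0≤∑ 0≤xˡ

    0≤b : 0ℚ ≤ b
    0≤b = 0≤∑ 0≤yˡ

    0≤1-a : 0ℚ ≤ 1ℚ - a
    0≤1-a = subst (0ℚ ≤_) ∑-right-x (0≤∑ 0≤xʳ)

    0≤1-b : 0ℚ ≤ 1ℚ - b
    0≤1-b = subst (0ℚ ≤_) ∑-right-y (0≤∑ 0≤yʳ)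

    a≤1 : a ≤ 1ℚ
    a≤1 = ≤-by-gap 0≤1-a refl

    b≤1 : b ≤ 1ℚ
    b≤1 = ≤-by-gap 0≤1-b refl

    1-a≤1 : 1ℚ - a ≤ 1ℚ
    1-a≤1 = ≤-by-gap 0≤a (solve 1 (λ a → a := con 1ℚ :- (con 1ℚ :- a)) refl a)

    1-b≤1 : 1ℚ - b ≤ 1ℚ
    1-b≤1 = ≤-by-gap 0≤b (solve 1 (λ b → b := con 1ℚ :- (con 1ℚ :- b)) refl b)

    0≤⅓-ε : 0ℚ ≤ ⅓ - ε
    0≤⅓-ε = 0≤-gap (<⇒≤ ε<⅓)

    s₀ : Fin n
    s₀ = proj₁ (∃∈-of-size-suc S size-S)

    s₀∈S : s₀ ∈ S
    s₀∈S = proj₂ (∃∈-of-size-suc S size-S)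

    incidence : (Fin n → ℚ) → Fin n → ℚ
    incidence v i = ∑[ j < n ] (χ (T j) i * v j)

    0≤incidence : ∀ {v} → (∀ j → 0ℚ ≤ v j) → ∀ i → 0ℚ ≤ incidence v i
    0≤incidence 0≤v i = 0≤∑ (λ j → 0≤* (0≤χ (T j) i) (0≤v j))

    incidence≤∑ : ∀ {v} → (∀ j → 0ℚ ≤ v j) → ∀ i → incidence v i ≤ ∑[ j < n ] v j
    incidence≤∑ 0≤v i = ∑c*w≤∑w (λ j → χ≤1 (T j) i) 0≤v

    incidence-yˡ≤b : ∀ i → incidence yˡ i ≤ b
    incidence-yˡ≤b = incidence≤∑ 0≤yˡ

    incidence-xʳ≤1-a : ∀ j → incidence xʳ j ≤ 1ℚ - a
    incidence-xʳ≤1-a j = subst (incidence xʳ j ≤_) ∑-right-x (incidence≤∑ 0≤xʳ j)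

    incidence-∉ : ∀ v {i} → i ∉ S → incidence v i ≡ 0ℚ
    incidence-∉ v i∉S = trans (sum-cong-≗ λ j → trans (cong (_* v j) (χ-∉ (i∉S ∘ T⊆S j))) (*-zeroˡ (v j))) (sum-replicate-zero n)

    weight-xˡ≤a : ∀ U → weight xˡ U ≤ a
    weight-xˡ≤a = weight≤∑ 0≤xˡ

    weight-yʳ≤1-b : ∀ U → weight yʳ U ≤ 1ℚ - b
    weight-yʳ≤1-b U = subst (weight yʳ U ≤_) ∑-right-y (weight≤∑ 0≤yʳ U)

    row-left : ∀ i → rowPayoff (R-mat S T) y (i ↑ˡ n) ≡ incidence yˡ i + χ S i * b + (+ 3 / 1 * b - two)
    row-left i = begin
      rowPayoff (R-mat S T) y (i ↑ˡ n)
        ≡⟨ rowPayoff-split {n} (R-mat S T) y (i ↑ˡ n) ⟩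
      ∑[ j < n ] (R-mat S T (i ↑ˡ n) (j ↑ˡ n) * yˡ j) + ∑[ j < n ] (R-mat S T (i ↑ˡ n) (n ↑ʳ j) * yʳ j)
        ≡⟨ cong₂ _+_ (sum-cong-≗ entry-ˡ) (sum-cong-≗ λ j → cong (_* yʳ j) (R-mat-↑ˡ↑ʳ S T i j)) ⟩
      ∑[ j < n ] (1ℚ * (χ (T j) i * yˡ j) + (1ℚ + χ S i) * yˡ j) + ∑[ j < n ] (- two * yʳ j)
        ≡⟨ cong₂ _+_ (∑-linear 1ℚ (1ℚ + χ S i) (λ j → χ (T j) i * yˡ j) yˡ) (sym (*-distribˡ-sum (- two) yʳ)) ⟩
      1ℚ * incidence yˡ i + (1ℚ + χ S i) * b + - two * ∑[ j < n ] yʳ j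
        ≡⟨ cong (λ r → 1ℚ * incidence yˡ i + (1ℚ + χ S i) * b + - two * r) ∑-right-y ⟩
      1ℚ * incidence yˡ i + (1ℚ + χ S i) * b + - two * (1ℚ - b)
        ≡⟨ solve 3 (λ P s b → con 1ℚ :* P :+ (con 1ℚ :+ s) :* b :+ :- con two :* (con 1ℚ :- b)
                              := P :+ s :* b :+ (con (+ 3 / 1) :* b :- con two)) refl (incidence yˡ i) (χ S i) b ⟩
      incidence yˡ i + χ S i * b + (+ 3 / 1 * b - two) ∎
      where
      open ≡-Reasoning
      entry-ˡ : ∀ j → R-mat S T (i ↑ˡ n) (j ↑ˡ n) * yˡ j ≡ 1ℚ * (χ (T j) i * yˡ j) + (1ℚ + χ S i) * yˡ j
      entry-ˡ j = trans (cong (_* yˡ j) (trans (R-mat-↑ˡ↑ˡ S T i j) (cong (_+_ two) (A-mat≡ T⊆S i j))))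
        (solve 3 (λ t s v → (con two :+ (t :+ s :- con 1ℚ)) :* v := con 1ℚ :* (t :* v) :+ (con 1ℚ :+ s) :* v) refl (χ (T j) i) (χ S i) (yˡ j))

    row-right : ∀ i → rowPayoff (R-mat S T) y (n ↑ʳ i) ≡ + 3 / 1 - + 5 / 1 * b - weight yʳ (T i)
    row-right i = begin
      rowPayoff (R-mat S T) y (n ↑ʳ i)
        ≡⟨ rowPayoff-split {n} (R-mat S T) y (n ↑ʳ i) ⟩
      ∑[ j < n ] (R-mat S T (n ↑ʳ i) (j ↑ˡ n) * yˡ j) + ∑[ j < n ] (R-mat S T (n ↑ʳ i) (n ↑ʳ j) * yʳ j)
        ≡⟨ cong₂ _+_ (sum-cong-≗ λ j → cong (_* yˡ j) (R-mat-↑ʳ↑ˡ S T i j)) (sum-cong-≗ entry-ʳ) ⟩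
      ∑[ j < n ] (- two * yˡ j) + ∑[ j < n ] (+ 3 / 1 * yʳ j + - 1ℚ * (χ (T i) j * yʳ j))
        ≡⟨ cong₂ _+_ (sym (*-distribˡ-sum (- two) yˡ)) (∑-linear (+ 3 / 1) (- 1ℚ) yʳ (λ j → χ (T i) j * yʳ j)) ⟩
      - two * b + (+ 3 / 1 * ∑[ j < n ] yʳ j + - 1ℚ * weight yʳ (T i))
        ≡⟨ cong (λ r → - two * b + (+ 3 / 1 * r + - 1ℚ * weight yʳ (T i))) ∑-right-y ⟩
      - two * b + (+ 3 / 1 * (1ℚ - b) + - 1ℚ * weight yʳ (T i))
        ≡⟨ solve 2 (λ b Q → :- con two :* b :+ (con (+ 3 / 1) :* (con 1ℚ :- b) :+ :- con 1ℚ :* Q)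
                            := con (+ 3 / 1) :- con (+ 5 / 1) :* b :- Q) refl b (weight yʳ (T i)) ⟩
      + 3 / 1 - + 5 / 1 * b - weight yʳ (T i) ∎
      where
      open ≡-Reasoning
      entry-ʳ : ∀ j → R-mat S T (n ↑ʳ i) (n ↑ʳ j) * yʳ j ≡ + 3 / 1 * yʳ j + - 1ℚ * (χ (T i) j * yʳ j)
      entry-ʳ j = trans (cong (_* yʳ j) (trans (R-mat-↑ʳ↑ʳ S T i j) (cong (_+_ two) (B-mat≡ T⊆S j i))))
        (solve 2 (λ t v → (con two :+ (con 1ℚ :- t)) :* v := con (+ 3 / 1) :* v :+ :- con 1ℚ :* (t :* v)) refl (χ (T i) j) (yʳ j))

    col-left : ∀ j → colPayoff (C-mat S T) x (j ↑ˡ n) ≡ two - + 3 / 1 * a - weight xˡ (T j)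
    col-left j = begin
      colPayoff (C-mat S T) x (j ↑ˡ n)
        ≡⟨ colPayoff-split {n} (C-mat S T) x (j ↑ˡ n) ⟩
      ∑[ i < n ] (xˡ i * C-mat S T (i ↑ˡ n) (j ↑ˡ n)) + ∑[ i < n ] (xʳ i * C-mat S T (n ↑ʳ i) (j ↑ˡ n))
        ≡⟨ cong₂ _+_ (sum-cong-≗ entry-ˡ) (sum-cong-≗ λ i → trans (cong (xʳ i *_) (C-mat-↑ʳ↑ˡ S T i j)) (*-comm (xʳ i) two)) ⟩
      ∑[ i < n ] (- 1ℚ * xˡ i + - 1ℚ * (χ (T j) i * xˡ i)) + ∑[ i < n ] (two * xʳ i)
        ≡⟨ cong₂ _+_ (∑-linear (- 1ℚ) (- 1ℚ) xˡ (λ i → χ (T j) i * xˡ i)) (sym (*-distribˡ-sum two xʳ)) ⟩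
      - 1ℚ * a + - 1ℚ * weight xˡ (T j) + two * ∑[ i < n ] xʳ i
        ≡⟨ cong (λ r → - 1ℚ * a + - 1ℚ * weight xˡ (T j) + two * r) ∑-right-x ⟩
      - 1ℚ * a + - 1ℚ * weight xˡ (T j) + two * (1ℚ - a)
        ≡⟨ solve 2 (λ a X → :- con 1ℚ :* a :+ :- con 1ℚ :* X :+ con two :* (con 1ℚ :- a)
                            := con two :- con (+ 3 / 1) :* a :- X) refl a (weight xˡ (T j)) ⟩
      two - + 3 / 1 * a - weight xˡ (T j) ∎
      where
      open ≡-Reasoning
      entry-ˡ : ∀ i → xˡ i * C-mat S T (i ↑ˡ n) (j ↑ˡ n) ≡ - 1ℚ * xˡ i + - 1ℚ * (χ (T j) i * xˡ i)
      entry-ˡ i = trans (cong (xˡ i *_) (trans (C-mat-↑ˡ↑ˡ S T i j) (cong (_+_ (- two)) (B-mat≡ T⊆S i j))))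
        (solve 2 (λ t v → v :* (:- con two :+ (con 1ℚ :- t)) := :- con 1ℚ :* v :+ :- con 1ℚ :* (t :* v)) refl (χ (T j) i) (xˡ i))

    col-right : ∀ j → colPayoff (C-mat S T) x (n ↑ʳ j) ≡ incidence xʳ j + χ S j * (1ℚ - a) + (+ 5 / 1 * a - + 3 / 1)
    col-right j = begin
      colPayoff (C-mat S T) x (n ↑ʳ j)
        ≡⟨ colPayoff-split {n} (C-mat S T) x (n ↑ʳ j) ⟩
      ∑[ i < n ] (xˡ i * C-mat S T (i ↑ˡ n) (n ↑ʳ j)) + ∑[ i < n ] (xʳ i * C-mat S T (n ↑ʳ i) (n ↑ʳ j))
        ≡⟨ cong₂ _+_ (sum-cong-≗ λ i → trans (cong (xˡ i *_) (C-mat-↑ˡ↑ʳ S T i j)) (*-comm (xˡ i) two)) (sum-cong-≗ entry-ʳ) ⟩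
      ∑[ i < n ] (two * xˡ i) + ∑[ i < n ] (1ℚ * (χ (T i) j * xʳ i) + (χ S j - + 3 / 1) * xʳ i)
        ≡⟨ cong₂ _+_ (sym (*-distribˡ-sum two xˡ)) (∑-linear 1ℚ (χ S j - + 3 / 1) (λ i → χ (T i) j * xʳ i) xʳ) ⟩
      two * a + (1ℚ * incidence xʳ j + (χ S j - + 3 / 1) * ∑[ i < n ] xʳ i)
        ≡⟨ cong (λ r → two * a + (1ℚ * incidence xʳ j + (χ S j - + 3 / 1) * r)) ∑-right-x ⟩
      two * a + (1ℚ * incidence xʳ j + (χ S j - + 3 / 1) * (1ℚ - a))
        ≡⟨ solve 3 (λ a Y s → con two :* a :+ (con 1ℚ :* Y :+ (s :- con (+ 3 / 1)) :* (con 1ℚ :- a))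
                              := Y :+ s :* (con 1ℚ :- a) :+ (con (+ 5 / 1) :* a :- con (+ 3 / 1))) refl a (incidence xʳ j) (χ S j) ⟩
      incidence xʳ j + χ S j * (1ℚ - a) + (+ 5 / 1 * a - + 3 / 1) ∎
      where
      open ≡-Reasoning
      entry-ʳ : ∀ i → xʳ i * C-mat S T (n ↑ʳ i) (n ↑ʳ j) ≡ 1ℚ * (χ (T i) j * xʳ i) + (χ S j - + 3 / 1) * xʳ i
      entry-ʳ i = trans (cong (xʳ i *_) (trans (C-mat-↑ʳ↑ʳ S T i j) (cong (_+_ (- two)) (A-mat≡ T⊆S j i))))
        (solve 3 (λ t s v → v :* (:- con two :+ (t :+ s :- con 1ℚ)) := con 1ℚ :* (t :* v) :+ (s :- con (+ 3 / 1)) :* v) refl (χ (T i) j) (χ S j) (xʳ i))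

    row-left-∈ : ∀ {i} → i ∈ S → rowPayoff (R-mat S T) y (i ↑ˡ n) ≡ incidence yˡ i + (+ 4 / 1 * b - two)
    row-left-∈ {i} i∈S = trans (row-left i) (trans (cong (λ c → incidence yˡ i + c * b + (+ 3 / 1 * b - two)) (χ-∈ i∈S))
      (solve 2 (λ P b → P :+ con 1ℚ :* b :+ (con (+ 3 / 1) :* b :- con two) := P :+ (con (+ 4 / 1) :* b :- con two)) refl (incidence yˡ i) b))

    row-left-∉ : ∀ {i} → i ∉ S → rowPayoff (R-mat S T) y (i ↑ˡ n) ≡ + 3 / 1 * b - two
    row-left-∉ {i} i∉S = trans (row-left i) (trans (cong₂ (λ P c → P + c * b + (+ 3 / 1 * b - two)) (incidence-∉ yˡ i∉S) (χ-∉ i∉S))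
      (solve 1 (λ b → con 0ℚ :+ con 0ℚ :* b :+ (con (+ 3 / 1) :* b :- con two) := con (+ 3 / 1) :* b :- con two) refl b))

    col-right-∈ : ∀ {j} → j ∈ S → colPayoff (C-mat S T) x (n ↑ʳ j) ≡ incidence xʳ j + (+ 4 / 1 * a - two)
    col-right-∈ {j} j∈S = trans (col-right j) (trans (cong (λ c → incidence xʳ j + c * (1ℚ - a) + (+ 5 / 1 * a - + 3 / 1)) (χ-∈ j∈S))
      (solve 2 (λ Y a → Y :+ con 1ℚ :* (con 1ℚ :- a) :+ (con (+ 5 / 1) :* a :- con (+ 3 / 1)) := Y :+ (con (+ 4 / 1) :* a :- con two)) refl (incidence xʳ j) a))

    col-right-∉ : ∀ {j} → j ∉ S → colPayoff (C-mat S T) x (n ↑ʳ j) ≡ + 5 / 1 * a - + 3 / 1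
    col-right-∉ {j} j∉S = trans (col-right j) (trans (cong₂ (λ Y c → Y + c * (1ℚ - a) + (+ 5 / 1 * a - + 3 / 1)) (incidence-∉ xʳ j∉S) (χ-∉ j∉S))
      (solve 1 (λ a → con 0ℚ :+ con 0ℚ :* (con 1ℚ :- a) :+ (con (+ 5 / 1) :* a :- con (+ 3 / 1)) := con (+ 5 / 1) :* a :- con (+ 3 / 1)) refl a))

    row-stable : ∀ {r} → 0ℚ < x r → ∀ {v} → rowPayoff (R-mat S T) y r ≡ v → ∀ r′ {u} → rowPayoff (R-mat S T) y r′ ≡ u → u - ε ≤ v
    row-stable {r} 0<xᵣ ≡v r′ ≡u = subst₂ (λ u v → u - ε ≤ v) ≡u ≡v (proj₁ (proj₂ (proj₂ wne)) r 0<xᵣ r′)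

    col-stable : ∀ {c} → 0ℚ < y c → ∀ {v} → colPayoff (C-mat S T) x c ≡ v → ∀ c′ {u} → colPayoff (C-mat S T) x c′ ≡ u → u - ε ≤ v
    col-stable {c} 0<yᶜ ≡v c′ ≡u = subst₂ (λ u v → u - ε ≤ v) ≡u ≡v (proj₂ (proj₂ (proj₂ wne)) c 0<yᶜ c′)

    -- Block masses and supports

    ⅓≤b-if-xˡ : ∀ {i} → 0ℚ < xˡ i → ⅓ ≤ b
    ⅓≤b-if-xˡ {i} 0<xᵢ = ≤-by-gap
      (0≤* (nonNegative⁻¹ (+ 1 / 9)) (+-mono-≤ (+-mono-≤ (+-mono-≤ (+-mono-≤ (0≤-gap stable) (0≤-gap (incidence-yˡ≤b i)))
        (0≤* 0≤b (0≤-gap (χ≤1 S i)))) (0≤-gap (weight-yʳ≤1-b (T i))))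
        (+-mono-≤ (nonNegative⁻¹ (+ 2 / 3)) 0≤⅓-ε)))
      (solve 5 (λ P Q s b e → con (+ 1 / 9) :* ((((P :+ s :* b :+ (con (+ 3 / 1) :* b :- con two)) :- (con (+ 3 / 1) :- con (+ 5 / 1) :* b :- Q :- e))
                                               :+ (b :- P) :+ b :* (con 1ℚ :- s) :+ ((con 1ℚ :- b) :- Q)) :+ (con (+ 2 / 3) :+ (con ⅓ :- e)))
                               := b :- con ⅓) refl (incidence yˡ i) (weight yʳ (T i)) (χ S i) b ε)
      where
      stable : + 3 / 1 - + 5 / 1 * b - weight yʳ (T i) - ε ≤ incidence yˡ i + χ S i * b + (+ 3 / 1 * b - two)
      stable = row-stable 0<xᵢ (row-left i) (n ↑ʳ i) (row-right i)

    ⅓≤1-b-if-xʳ : ∀ {i} → 0ℚ < xʳ i → ⅓ ≤ 1ℚ - b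
    ⅓≤1-b-if-xʳ {i} 0<xᵢ = ≤-by-gap
      (0≤* (nonNegative⁻¹ (+ 1 / 9)) (+-mono-≤ (+-mono-≤ (+-mono-≤ (0≤-gap stable) (0≤incidence 0≤yˡ s₀))
        (0≤weight 0≤yʳ (T i))) (+-mono-≤ (nonNegative⁻¹ (+ 2 / 3)) 0≤⅓-ε)))
      (solve 4 (λ P Q b e → con (+ 1 / 9) :* ((((con (+ 3 / 1) :- con (+ 5 / 1) :* b :- Q) :- (P :+ (con (+ 4 / 1) :* b :- con two) :- e))
                                               :+ P :+ Q) :+ (con (+ 2 / 3) :+ (con ⅓ :- e)))
                             := (con 1ℚ :- b) :- con ⅓) refl (incidence yˡ s₀) (weight yʳ (T i)) b ε)
      where
      stable : incidence yˡ s₀ + (+ 4 / 1 * b - two) - ε ≤ + 3 / 1 - + 5 / 1 * b - weight yʳ (T i)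
      stable = row-stable 0<xᵢ (row-right i) (s₀ ↑ˡ n) (row-left-∈ s₀∈S)

    ⅓≤1-a-if-yˡ : ∀ {j} → 0ℚ < yˡ j → ⅓ ≤ 1ℚ - a
    ⅓≤1-a-if-yˡ {j} 0<yⱼ = ≤-by-gap
      (0≤* (nonNegative⁻¹ (+ 1 / 7)) (+-mono-≤ (+-mono-≤ (+-mono-≤ (0≤-gap stable) (0≤weight 0≤xˡ (T j)))
        (0≤incidence 0≤xʳ s₀)) (+-mono-≤ (nonNegative⁻¹ ⅓) 0≤⅓-ε)))
      (solve 4 (λ X Y a e → con (+ 1 / 7) :* ((((con two :- con (+ 3 / 1) :* a :- X) :- (Y :+ (con (+ 4 / 1) :* a :- con two) :- e))
                                               :+ X :+ Y) :+ (con ⅓ :+ (con ⅓ :- e)))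
                             := (con 1ℚ :- a) :- con ⅓) refl (weight xˡ (T j)) (incidence xʳ s₀) a ε)
      where
      stable : incidence xʳ s₀ + (+ 4 / 1 * a - two) - ε ≤ two - + 3 / 1 * a - weight xˡ (T j)
      stable = col-stable 0<yⱼ (col-left j) (n ↑ʳ s₀) (col-right-∈ s₀∈S)

    ⅓≤a-if-yʳ : ∀ {j} → 0ℚ < yʳ j → ⅓ ≤ a
    ⅓≤a-if-yʳ {j} 0<yⱼ = ≤-by-gap
      (0≤* (nonNegative⁻¹ (+ 1 / 7)) (+-mono-≤ (+-mono-≤ (+-mono-≤ (+-mono-≤ (0≤-gap stable) (0≤* 0≤1-a (0≤-gap (χ≤1 S j))))
        (0≤-gap (incidence-xʳ≤1-a j)))
        (0≤-gap (weight-xˡ≤a (T j)))) (+-mono-≤ (nonNegative⁻¹ ⅓) 0≤⅓-ε)))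
      (solve 5 (λ X Y s a e → con (+ 1 / 7) :* ((((Y :+ s :* (con 1ℚ :- a) :+ (con (+ 5 / 1) :* a :- con (+ 3 / 1))) :- (con two :- con (+ 3 / 1) :* a :- X :- e))
                                                 :+ (con 1ℚ :- a) :* (con 1ℚ :- s) :+ ((con 1ℚ :- a) :- Y) :+ (a :- X)) :+ (con ⅓ :+ (con ⅓ :- e)))
                               := a :- con ⅓) refl (weight xˡ (T j)) (incidence xʳ j) (χ S j) a ε)
      where
      stable : two - + 3 / 1 * a - weight xˡ (T j) - ε ≤ incidence xʳ j + χ S j * (1ℚ - a) + (+ 5 / 1 * a - + 3 / 1)
      stable = col-stable 0<yⱼ (col-right j) (j ↑ˡ n) (col-left j)

    -- Positivity of each mass gives ⅓ ≤ the next one along a → b → 1 - a → 1 - b → a,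
    -- and a or 1 - a is positive.
    ⅓≤-masses : ⅓ ≤ a × ⅓ ≤ b × ⅓ ≤ 1ℚ - a × ⅓ ≤ 1ℚ - b
    ⅓≤-masses = from (0ℚ <? a)
      where
      b-step : 0ℚ < a → ⅓ ≤ b
      b-step 0<a = ⅓≤b-if-xˡ (proj₂ (0<∑⇒∃0< xˡ 0<a))
      1-a-step : ⅓ ≤ b → ⅓ ≤ 1ℚ - a
      1-a-step ⅓≤b = ⅓≤1-a-if-yˡ (proj₂ (0<∑⇒∃0< yˡ (⅓≤⇒0< ⅓≤b)))
      1-b-step : 0ℚ < 1ℚ - a → ⅓ ≤ 1ℚ - b
      1-b-step 0<1-a = ⅓≤1-b-if-xʳ (proj₂ (0<∑⇒∃0< xʳ (subst (0ℚ <_) (sym ∑-right-x) 0<1-a)))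
      a-step : ⅓ ≤ 1ℚ - b → ⅓ ≤ a
      a-step ⅓≤1-b = ⅓≤a-if-yʳ (proj₂ (0<∑⇒∃0< yʳ (subst (0ℚ <_) (sym ∑-right-y) (⅓≤⇒0< ⅓≤1-b))))
      from : Dec (0ℚ < a) → ⅓ ≤ a × ⅓ ≤ b × ⅓ ≤ 1ℚ - a × ⅓ ≤ 1ℚ - b
      from (yes 0<a) = let ⅓≤b = b-step 0<a; ⅓≤1-a = 1-a-step ⅓≤b; ⅓≤1-b = 1-b-step (⅓≤⇒0< ⅓≤1-a)
                       in a-step ⅓≤1-b , ⅓≤b , ⅓≤1-a , ⅓≤1-b
      from (no 0≮a)  = let ⅓≤1-b = 1-b-step 0<1-a; ⅓≤a = a-step ⅓≤1-b; ⅓≤b = b-step (⅓≤⇒0< ⅓≤a)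
                       in ⅓≤a , ⅓≤b , 1-a-step ⅓≤b , ⅓≤1-b
        where
        0<1-a : 0ℚ < 1ℚ - a
        0<1-a = <-≤-trans (positive⁻¹ 1ℚ) (≤-by-gap (0≤-gap (≮⇒≥ 0≮a)) (solve 1 (λ a → con 0ℚ :- a := (con 1ℚ :- a) :- con 1ℚ) refl a))

    ⅓≤a : ⅓ ≤ a
    ⅓≤a = proj₁ ⅓≤-masses

    ⅓≤b : ⅓ ≤ b
    ⅓≤b = proj₁ (proj₂ ⅓≤-masses)

    ⅓≤1-a : ⅓ ≤ 1ℚ - a
    ⅓≤1-a = proj₁ (proj₂ (proj₂ ⅓≤-masses))

    ⅓≤1-b : ⅓ ≤ 1ℚ - b
    ⅓≤1-b = proj₂ (proj₂ (proj₂ ⅓≤-masses))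

    supp-xˡ : SuppIn xˡ S
    supp-xˡ i xᵢ≢0 with i ∈? S
    ... | yes i∈S = i∈S
    ... | no  i∉S = ⊥-elim (<-irrefl refl (≤-<-trans ⅓≤b (≤-<-trans b≤ε ε<⅓)))
      where
      stable : incidence yˡ s₀ + (+ 4 / 1 * b - two) - ε ≤ + 3 / 1 * b - two
      stable = row-stable (≤∧≢0⇒0< (0≤xˡ i) xᵢ≢0) (row-left-∉ i∉S) (s₀ ↑ˡ n) (row-left-∈ s₀∈S)
      b≤ε : b ≤ ε
      b≤ε = ≤-by-gap (+-mono-≤ (0≤-gap stable) (0≤incidence 0≤yˡ s₀))
        (solve 3 (λ P b e → (con (+ 3 / 1) :* b :- con two) :- (P :+ (con (+ 4 / 1) :* b :- con two) :- e) :+ P := e :- b) refl (incidence yˡ s₀) b ε)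

    supp-yʳ : SuppIn yʳ S
    supp-yʳ j yⱼ≢0 with j ∈? S
    ... | yes j∈S = j∈S
    ... | no  j∉S = ⊥-elim (<-irrefl refl (≤-<-trans ⅓≤1-a (≤-<-trans 1-a≤ε ε<⅓)))
      where
      stable : incidence xʳ s₀ + (+ 4 / 1 * a - two) - ε ≤ + 5 / 1 * a - + 3 / 1
      stable = col-stable (≤∧≢0⇒0< (0≤yʳ j) yⱼ≢0) (col-right-∉ j∉S) (n ↑ʳ s₀) (col-right-∈ s₀∈S)
      1-a≤ε : 1ℚ - a ≤ ε
      1-a≤ε = ≤-by-gap (+-mono-≤ (0≤-gap stable) (0≤incidence 0≤xʳ s₀))
        (solve 3 (λ Y a e → (con (+ 5 / 1) :* a :- con (+ 3 / 1)) :- (Y :+ (con (+ 4 / 1) :* a :- con two) :- e) :+ Y := e :- (con 1ℚ :- a)) refl (incidence xʳ s₀) a ε)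

    payoff-xˡ payoff-xʳ payoff-yˡ payoff-yʳ : ℚ
    payoff-xˡ = ∑[ i < n ] (xˡ i * rowPayoff (R-mat S T) y (i ↑ˡ n))
    payoff-xʳ = ∑[ i < n ] (xʳ i * rowPayoff (R-mat S T) y (n ↑ʳ i))
    payoff-yˡ = ∑[ j < n ] (yˡ j * colPayoff (C-mat S T) x (j ↑ˡ n))
    payoff-yʳ = ∑[ j < n ] (yʳ j * colPayoff (C-mat S T) x (n ↑ʳ j))

    a*[u-ε]≤payoff-xˡ : ∀ r {u} → rowPayoff (R-mat S T) y r ≡ u → a * (u - ε) ≤ payoff-xˡ
    a*[u-ε]≤payoff-xˡ r ≡u = [∑w]*c≤∑w*f 0≤xˡ (λ i 0<xᵢ → row-stable 0<xᵢ refl r ≡u)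

    [1-a]*[u-ε]≤payoff-xʳ : ∀ r {u} → rowPayoff (R-mat S T) y r ≡ u → (1ℚ - a) * (u - ε) ≤ payoff-xʳ
    [1-a]*[u-ε]≤payoff-xʳ r ≡u = subst (λ m → m * _ ≤ payoff-xʳ) ∑-right-x ([∑w]*c≤∑w*f 0≤xʳ (λ i 0<xᵢ → row-stable 0<xᵢ refl r ≡u))

    b*[u-ε]≤payoff-yˡ : ∀ c {u} → colPayoff (C-mat S T) x c ≡ u → b * (u - ε) ≤ payoff-yˡ
    b*[u-ε]≤payoff-yˡ c ≡u = [∑w]*c≤∑w*f 0≤yˡ (λ j 0<yⱼ → col-stable 0<yⱼ refl c ≡u)

    [1-b]*[u-ε]≤payoff-yʳ : ∀ c {u} → colPayoff (C-mat S T) x c ≡ u → (1ℚ - b) * (u - ε) ≤ payoff-yʳ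
    [1-b]*[u-ε]≤payoff-yʳ c ≡u = subst (λ m → m * _ ≤ payoff-yʳ) ∑-right-y ([∑w]*c≤∑w*f 0≤yʳ (λ j 0<yⱼ → col-stable 0<yⱼ refl c ≡u))

    bilinearˡ bilinearʳ : ℚ
    bilinearˡ = ∑[ i < n ] (xˡ i * incidence yˡ i)
    bilinearʳ = ∑[ i < n ] (xʳ i * weight yʳ (T i))

    payoff-xˡ≡ : payoff-xˡ ≡ bilinearˡ + a * (+ 4 / 1 * b - two)
    payoff-xˡ≡ = begin
      payoff-xˡ
        ≡⟨ sum-cong-≗ (*-congˡ-on-support (off-support supp-xˡ) row-left-∈) ⟩
      ∑[ i < n ] (xˡ i * (incidence yˡ i + c))
        ≡⟨ sum-cong-≗ (λ i → *-distribˡ-+ (xˡ i) (incidence yˡ i) c) ⟩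
      ∑[ i < n ] (xˡ i * incidence yˡ i + xˡ i * c)
        ≡⟨ ∑-distrib-+ (λ i → xˡ i * incidence yˡ i) (λ i → xˡ i * c) ⟩
      bilinearˡ + ∑[ i < n ] (xˡ i * c)
        ≡⟨ cong (_+_ bilinearˡ) (sym (*-distribʳ-sum c xˡ)) ⟩
      bilinearˡ + a * c ∎
      where
      open ≡-Reasoning
      c : ℚ
      c = + 4 / 1 * b - two

    payoff-yˡ≡ : payoff-yˡ ≡ b * (two - + 3 / 1 * a) - bilinearˡ
    payoff-yˡ≡ = begin
      payoff-yˡ
        ≡⟨ sum-cong-≗ (λ j → trans (cong (yˡ j *_) (col-left j)) (solve 3 (λ y c X → y :* (c :- X) := y :* c :- y :* X) refl (yˡ j) c (weight xˡ (T j)))) ⟩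
      ∑[ j < n ] (yˡ j * c - yˡ j * weight xˡ (T j))
        ≡⟨ ∑-distrib-- (λ j → yˡ j * c) (λ j → yˡ j * weight xˡ (T j)) ⟩
      ∑[ j < n ] (yˡ j * c) - ∑[ j < n ] (yˡ j * weight xˡ (T j))
        ≡⟨ cong₂ _-_ (sym (*-distribʳ-sum c yˡ)) (sym (∑∑-swap xˡ yˡ (λ i j → χ (T j) i))) ⟩
      b * c - bilinearˡ ∎
      where
      open ≡-Reasoning
      c : ℚ
      c = two - + 3 / 1 * a

    payoff-xʳ≡ : payoff-xʳ ≡ (1ℚ - a) * (+ 3 / 1 - + 5 / 1 * b) - bilinearʳ
    payoff-xʳ≡ = begin
      payoff-xʳ
        ≡⟨ sum-cong-≗ (λ i → trans (cong (xʳ i *_) (row-right i)) (solve 3 (λ x c Q → x :* (c :- Q) := x :* c :- x :* Q) refl (xʳ i) c (weight yʳ (T i)))) ⟩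
      ∑[ i < n ] (xʳ i * c - xʳ i * weight yʳ (T i))
        ≡⟨ ∑-distrib-- (λ i → xʳ i * c) (λ i → xʳ i * weight yʳ (T i)) ⟩
      ∑[ i < n ] (xʳ i * c) - bilinearʳ
        ≡⟨ cong (_- bilinearʳ) (trans (sym (*-distribʳ-sum c xʳ)) (cong (_* c) ∑-right-x)) ⟩
      (1ℚ - a) * c - bilinearʳ ∎
      where
      open ≡-Reasoning
      c : ℚ
      c = + 3 / 1 - + 5 / 1 * b

    payoff-yʳ≡ : payoff-yʳ ≡ bilinearʳ + (1ℚ - b) * (+ 4 / 1 * a - two)
    payoff-yʳ≡ = begin
      payoff-yʳ
        ≡⟨ sum-cong-≗ (*-congˡ-on-support (off-support supp-yʳ) col-right-∈) ⟩
      ∑[ j < n ] (yʳ j * (incidence xʳ j + c))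
        ≡⟨ sum-cong-≗ (λ j → *-distribˡ-+ (yʳ j) (incidence xʳ j) c) ⟩
      ∑[ j < n ] (yʳ j * incidence xʳ j + yʳ j * c)
        ≡⟨ ∑-distrib-+ (λ j → yʳ j * incidence xʳ j) (λ j → yʳ j * c) ⟩
      ∑[ j < n ] (yʳ j * incidence xʳ j) + ∑[ j < n ] (yʳ j * c)
        ≡⟨ cong₂ _+_ (sym (∑∑-swap xʳ yʳ (λ i j → χ (T i) j))) (trans (sym (*-distribʳ-sum c yʳ)) (cong (_* c) ∑-right-y)) ⟩
      bilinearʳ + (1ℚ - b) * c ∎
      where
      open ≡-Reasoning
      c : ℚ
      c = + 4 / 1 * a - two

    -- A + B = χ_S 1ᵀ on the left blocks and Bᵀ + Aᵀ = 1 χ_Sᵀ on the right ones, so the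
    -- bilinear parts of the two players' block payoffs cancel.
    payoff-xˡ+payoff-yˡ≡ : payoff-xˡ + payoff-yˡ ≡ a * b + two * b - two * a
    payoff-xˡ+payoff-yˡ≡ = trans (cong₂ _+_ payoff-xˡ≡ payoff-yˡ≡)
      (solve 3 (λ E a b → E :+ a :* (con (+ 4 / 1) :* b :- con two) :+ (b :* (con two :- con (+ 3 / 1) :* a) :- E)
                          := a :* b :+ con two :* b :- con two :* a) refl bilinearˡ a b)

    payoff-xʳ+payoff-yʳ≡ : payoff-xʳ + payoff-yʳ ≡ (1ℚ - a) * (1ℚ - b) + two * a - two * b
    payoff-xʳ+payoff-yʳ≡ = trans (cong₂ _+_ payoff-xʳ≡ payoff-yʳ≡)
      (solve 3 (λ E a b → (con 1ℚ :- a) :* (con (+ 3 / 1) :- con (+ 5 / 1) :* b) :- E :+ (E :+ (con 1ℚ :- b) :* (con (+ 4 / 1) :* a :- con two))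
                          := (con 1ℚ :- a) :* (con 1ℚ :- b) :+ con two :* a :- con two :* b) refl bilinearʳ a b)

    left-balance : ∀ {u v} → a * u ≤ payoff-xˡ → b * v ≤ payoff-yˡ → a * u + b * v ≤ a * b + two * b - two * a
    left-balance au≤ bv≤ = ≤-trans (+-mono-≤ au≤ bv≤) (≤-reflexive payoff-xˡ+payoff-yˡ≡)

    right-balance : ∀ {u v} → (1ℚ - a) * u ≤ payoff-xʳ → (1ℚ - b) * v ≤ payoff-yʳ →
                    (1ℚ - a) * u + (1ℚ - b) * v ≤ (1ℚ - a) * (1ℚ - b) + two * a - two * b
    right-balance au≤ bv≤ = ≤-trans (+-mono-≤ au≤ bv≤) (≤-reflexive payoff-xʳ+payoff-yʳ≡)

    ∑χS≡ : ∑[ i < n ] χ S i ≡ suc k · 1ℚ + suc k · 1ℚ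
    ∑χS≡ = trans (∑χ≡size S) (trans (cong (_· 1ℚ) size-S) (·-homo-+ 1ℚ (suc k) (suc k)))

    0<∑χS : 0ℚ < ∑[ i < n ] χ S i
    0<∑χS = subst (0ℚ <_) (sym ∑χS≡) (+-mono-< (0<suc·1 k) (0<suc·1 k))

    weight-χS : ∀ j → weight (χ S) (T j) ≡ suc k · 1ℚ
    weight-χS j = trans (sum-cong-≗ χTχS≡χT) (trans (∑χ≡size (T j)) (cong (_· 1ℚ) (size-T j)))
      where
      χTχS≡χT : ∀ i → χ (T j) i * χ S i ≡ χ (T j) i
      χTχS≡χT i with i ∈? T j
      ... | yes i∈Tj = trans (cong₂ _*_ (χ-∈ i∈Tj) (χ-∈ (T⊆S j i∈Tj))) (sym (χ-∈ i∈Tj))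
      ... | no  i∉Tj = trans (cong (_* χ S i) (χ-∉ i∉Tj)) (trans (*-zeroˡ (χ S i)) (sym (χ-∉ i∉Tj)))

    mean-incidence : ∀ v → ∑[ i < n ] (χ S i * incidence v i) ≡ (∑[ i < n ] χ S i) * (∑[ j < n ] v j * ½)
    mean-incidence v = begin
      ∑[ i < n ] (χ S i * incidence v i)      ≡⟨ ∑∑-swap (χ S) v (λ i j → χ (T j) i) ⟩
      ∑[ j < n ] (v j * weight (χ S) (T j))   ≡⟨ sum-cong-≗ (λ j → cong (v j *_) (weight-χS j)) ⟩
      ∑[ j < n ] (v j * H)                    ≡⟨ sym (*-distribʳ-sum H v) ⟩
      (∑[ j < n ] v j) * H                    ≡⟨ solve 2 (λ V H → V :* H := (H :+ H) :* (V :* con ½)) refl (∑[ j < n ] v j) H ⟩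
      (H + H) * (∑[ j < n ] v j * ½)          ≡⟨ cong (_* (∑[ j < n ] v j * ½)) (sym ∑χS≡) ⟩
      (∑[ i < n ] χ S i) * (∑[ j < n ] v j * ½) ∎
      where
      open ≡-Reasoning
      H : ℚ
      H = suc k · 1ℚ

    mean-incidence-xʳ : ∑[ i < n ] (χ S i * incidence xʳ i) ≡ (∑[ i < n ] χ S i) * ((1ℚ - a) * ½)
    mean-incidence-xʳ = trans (mean-incidence xʳ) (cong (λ s → (∑[ i < n ] χ S i) * (s * ½)) ∑-right-x)

    row-mean : ℚ
    row-mean = b * ½ + (+ 4 / 1 * b - two - ε)

    col-mean : ℚ
    col-mean = (1ℚ - a) * ½ + (+ 4 / 1 * a - two - ε)

    a*row-mean≤payoff-xˡ : a * row-mean ≤ payoff-xˡ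
    a*row-mean≤payoff-xˡ = mean-≤ S 0<∑χS (mean-incidence yˡ) {a} {+ 4 / 1 * b - two - ε} λ {s} s∈S →
      subst (_≤ payoff-xˡ) (cong (a *_) (+-assoc (incidence yˡ s) _ (- ε))) (a*[u-ε]≤payoff-xˡ (s ↑ˡ n) (row-left-∈ s∈S))

    [1-a]*row-mean≤payoff-xʳ : (1ℚ - a) * row-mean ≤ payoff-xʳ
    [1-a]*row-mean≤payoff-xʳ = mean-≤ S 0<∑χS (mean-incidence yˡ) {1ℚ - a} {+ 4 / 1 * b - two - ε} λ {s} s∈S →
      subst (_≤ payoff-xʳ) (cong ((1ℚ - a) *_) (+-assoc (incidence yˡ s) _ (- ε))) ([1-a]*[u-ε]≤payoff-xʳ (s ↑ˡ n) (row-left-∈ s∈S))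

    b*col-mean≤payoff-yˡ : b * col-mean ≤ payoff-yˡ
    b*col-mean≤payoff-yˡ = mean-≤ S 0<∑χS mean-incidence-xʳ {b} {+ 4 / 1 * a - two - ε} λ {s} s∈S →
      subst (_≤ payoff-yˡ) (cong (b *_) (+-assoc (incidence xʳ s) _ (- ε))) (b*[u-ε]≤payoff-yˡ (n ↑ʳ s) (col-right-∈ s∈S))

    [1-b]*col-mean≤payoff-yʳ : (1ℚ - b) * col-mean ≤ payoff-yʳ
    [1-b]*col-mean≤payoff-yʳ = mean-≤ S 0<∑χS mean-incidence-xʳ {1ℚ - b} {+ 4 / 1 * a - two - ε} λ {s} s∈S →
      subst (_≤ payoff-yʳ) (cong ((1ℚ - b) *_) (+-assoc (incidence xʳ s) _ (- ε))) ([1-b]*[u-ε]≤payoff-yʳ (n ↑ʳ s) (col-right-∈ s∈S))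

    -- Masses ½ up to ε

    lightest-xˡ : ∃ λ j → weight xˡ (T j) + weight xˡ (T j) ≤ a
    lightest-xˡ = lighter-half S T size-S T⊆S size-T T-onto xˡ (off-support supp-xˡ)

    lightest-yʳ : ∃ λ j → weight yʳ (T j) + weight yʳ (T j) ≤ 1ℚ - b
    lightest-yʳ with lighter-half S T size-S T⊆S size-T T-onto yʳ (off-support supp-yʳ)
    ... | j , W+W≤∑ = j , subst (weight yʳ (T j) + weight yʳ (T j) ≤_) ∑-right-y W+W≤∑

    7[a-½]≤4ε : + 7 / 1 * (a - ½) ≤ + 4 / 1 * ε
    7[a-½]≤4ε = m*d≤e*[l+m]⇒d≤4e 0≤ε a≤1 ⅓≤b (≤-by-gap (0≤-gap (left-balance a*row-mean≤payoff-xˡ b*col-mean≤payoff-yˡ))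
      (solve 3 (λ a b e → (a :* b :+ con two :* b :- con two :* a)
                          :- (a :* (b :* con ½ :+ (con (+ 4 / 1) :* b :- con two :- e)) :+ b :* ((con 1ℚ :- a) :* con ½ :+ (con (+ 4 / 1) :* a :- con two :- e)))
                          := e :* (a :+ b) :- b :* (con (+ 7 / 1) :* (a :- con ½))) refl a b ε))

    7[½-a]≤4ε : + 7 / 1 * (½ - a) ≤ + 4 / 1 * ε
    7[½-a]≤4ε = m*d≤e*[l+m]⇒d≤4e 0≤ε 1-a≤1 ⅓≤1-b (≤-by-gap
      (+-mono-≤ (+-mono-≤ (0≤-gap balance) (0≤* (0≤* 0≤1-a (nonNegative⁻¹ ½)) (0≤-gap (proj₂ lightest-yʳ))))
           (0≤* (0≤* 0≤1-b (nonNegative⁻¹ ½)) (0≤-gap (proj₂ lightest-xˡ))))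
      (solve 5 (λ a b X Q e → ((con 1ℚ :- a) :* (con 1ℚ :- b) :+ con two :* a :- con two :* b)
                              :- ((con 1ℚ :- a) :* (con (+ 3 / 1) :- con (+ 5 / 1) :* b :- Q :- e) :+ (con 1ℚ :- b) :* (con two :- con (+ 3 / 1) :* a :- X :- e))
                              :+ (con 1ℚ :- a) :* con ½ :* ((con 1ℚ :- b) :- (Q :+ Q)) :+ (con 1ℚ :- b) :* con ½ :* (a :- (X :+ X))
                              := e :* ((con 1ℚ :- a) :+ (con 1ℚ :- b)) :- (con 1ℚ :- b) :* (con (+ 7 / 1) :* (con ½ :- a)))
             refl a b (weight xˡ (T (proj₁ lightest-xˡ))) (weight yʳ (T (proj₁ lightest-yʳ))) ε))
      where
      balance : (1ℚ - a) * (+ 3 / 1 - + 5 / 1 * b - weight yʳ (T (proj₁ lightest-yʳ)) - ε) + (1ℚ - b) * (two - + 3 / 1 * a - weight xˡ (T (proj₁ lightest-xˡ)) - ε)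
                ≤ (1ℚ - a) * (1ℚ - b) + two * a - two * b
      balance = right-balance ([1-a]*[u-ε]≤payoff-xʳ (n ↑ʳ proj₁ lightest-yʳ) (row-right _)) ([1-b]*[u-ε]≤payoff-yʳ (proj₁ lightest-xˡ ↑ˡ n) (col-left _))

    9[b-½]≤4ε : + 9 / 1 * (b - ½) ≤ + 4 / 1 * ε
    9[b-½]≤4ε = m*d≤e*[l+m]⇒d≤4e 0≤ε 1-b≤1 ⅓≤1-a (≤-by-gap (0≤-gap (right-balance [1-a]*row-mean≤payoff-xʳ [1-b]*col-mean≤payoff-yʳ))
      (solve 3 (λ a b e → ((con 1ℚ :- a) :* (con 1ℚ :- b) :+ con two :* a :- con two :* b)
                          :- ((con 1ℚ :- a) :* (b :* con ½ :+ (con (+ 4 / 1) :* b :- con two :- e)) :+ (con 1ℚ :- b) :* ((con 1ℚ :- a) :* con ½ :+ (con (+ 4 / 1) :* a :- con two :- e)))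
                          := e :* ((con 1ℚ :- b) :+ (con 1ℚ :- a)) :- (con 1ℚ :- a) :* (con (+ 9 / 1) :* (b :- con ½))) refl a b ε))

    9[½-b]≤4ε : + 9 / 1 * (½ - b) ≤ + 4 / 1 * ε
    9[½-b]≤4ε = m*d≤e*[l+m]⇒d≤4e 0≤ε b≤1 ⅓≤a (≤-by-gap
      (+-mono-≤ (+-mono-≤ (0≤-gap balance) (0≤* (0≤* 0≤a (nonNegative⁻¹ ½)) (0≤-gap (proj₂ lightest-yʳ))))
           (0≤* (0≤* 0≤b (nonNegative⁻¹ ½)) (0≤-gap (proj₂ lightest-xˡ))))
      (solve 5 (λ a b X Q e → (a :* b :+ con two :* b :- con two :* a)
                              :- (a :* (con (+ 3 / 1) :- con (+ 5 / 1) :* b :- Q :- e) :+ b :* (con two :- con (+ 3 / 1) :* a :- X :- e))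
                              :+ a :* con ½ :* ((con 1ℚ :- b) :- (Q :+ Q)) :+ b :* con ½ :* (a :- (X :+ X))
                              := e :* (b :+ a) :- a :* (con (+ 9 / 1) :* (con ½ :- b)))
             refl a b (weight xˡ (T (proj₁ lightest-xˡ))) (weight yʳ (T (proj₁ lightest-yʳ))) ε))
      where
      balance : a * (+ 3 / 1 - + 5 / 1 * b - weight yʳ (T (proj₁ lightest-yʳ)) - ε) + b * (two - + 3 / 1 * a - weight xˡ (T (proj₁ lightest-xˡ)) - ε)
                ≤ a * b + two * b - two * a
      balance = left-balance (a*[u-ε]≤payoff-xˡ (n ↑ʳ proj₁ lightest-yʳ) (row-right _)) (b*[u-ε]≤payoff-yˡ (proj₁ lightest-xˡ ↑ˡ n) (col-left _))

    a½-X≤4ε : ∀ j → a * ½ - weight xˡ (T j) ≤ + 4 / 1 * ε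
    a½-X≤4ε j = m*d≤e*[l+m]⇒d≤4e 0≤ε a≤1 ⅓≤b (≤-by-gap (0≤-gap (left-balance a*row-mean≤payoff-xˡ (b*[u-ε]≤payoff-yˡ (j ↑ˡ n) (col-left j))))
      (solve 4 (λ a b X e → (a :* b :+ con two :* b :- con two :* a)
                            :- (a :* (b :* con ½ :+ (con (+ 4 / 1) :* b :- con two :- e)) :+ b :* (con two :- con (+ 3 / 1) :* a :- X :- e))
                            := e :* (a :+ b) :- b :* (a :* con ½ :- X)) refl a b (weight xˡ (T j)) ε))

    [1-b]½-Q≤4ε : ∀ j → (1ℚ - b) * ½ - weight yʳ (T j) ≤ + 4 / 1 * ε
    [1-b]½-Q≤4ε j = m*d≤e*[l+m]⇒d≤4e 0≤ε 1-b≤1 ⅓≤1-a (≤-by-gap (0≤-gap (right-balance ([1-a]*[u-ε]≤payoff-xʳ (n ↑ʳ j) (row-right j)) [1-b]*col-mean≤payoff-yʳ))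
      (solve 4 (λ a b Q e → ((con 1ℚ :- a) :* (con 1ℚ :- b) :+ con two :* a :- con two :* b)
                            :- ((con 1ℚ :- a) :* (con (+ 3 / 1) :- con (+ 5 / 1) :* b :- Q :- e) :+ (con 1ℚ :- b) :* ((con 1ℚ :- a) :* con ½ :+ (con (+ 4 / 1) :* a :- con two :- e)))
                            := e :* ((con 1ℚ :- b) :+ (con 1ℚ :- a)) :- (con 1ℚ :- a) :* ((con 1ℚ :- b) :* con ½ :- Q)) refl a b (weight yʳ (T j)) ε))

    ∣a-½∣≤ε : ∣ a - ½ ∣ ≤ ε
    ∣a-½∣≤ε = ∣p-q∣≤ {a} {½} (c*d≤4e⇒d≤e 4≤7 0≤ε 7[a-½]≤4ε) (c*d≤4e⇒d≤e 4≤7 0≤ε 7[½-a]≤4ε)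
      where
      4≤7 : + 4 / 1 ≤ + 7 / 1
      4≤7 = ≤-by-gap (nonNegative⁻¹ (+ 3 / 1)) refl

    ∣[1-b]-½∣≤ε : ∣ (1ℚ - b) - ½ ∣ ≤ ε
    ∣[1-b]-½∣≤ε = ∣p-q∣≤ {1ℚ - b} {½} (subst (_≤ ε) (solve 1 (λ b → con ½ :- b := (con 1ℚ :- b) :- con ½) refl b) (c*d≤4e⇒d≤e 4≤9 0≤ε 9[½-b]≤4ε))
                         (subst (_≤ ε) (solve 1 (λ b → b :- con ½ := con ½ :- (con 1ℚ :- b)) refl b) (c*d≤4e⇒d≤e 4≤9 0≤ε 9[b-½]≤4ε))
      where
      4≤9 : + 4 / 1 ≤ + 9 / 1
      4≤9 = ≤-by-gap (nonNegative⁻¹ (+ 5 / 1)) refl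

    u : ℚ
    u = (+ 1 / (2 ℕ.* suc k)) * ½

    ∑χS*u≡½ : (∑[ i < n ] χ S i) * u ≡ ½
    ∑χS*u≡½ = begin
      (∑[ i < n ] χ S i) * u
        ≡⟨ cong (_* u) (trans (∑χ≡size S) (cong (_· 1ℚ) (trans size-S (cong (ℕ._+_ (suc k)) (sym (ℕ.+-identityʳ (suc k))))))) ⟩
      ((2 ℕ.* suc k) · 1ℚ) * ((+ 1 / (2 ℕ.* suc k)) * ½)
        ≡⟨ sym (*-assoc ((2 ℕ.* suc k) · 1ℚ) (+ 1 / (2 ℕ.* suc k)) ½) ⟩
      ((2 ℕ.* suc k) · 1ℚ) * (+ 1 / (2 ℕ.* suc k)) * ½
        ≡⟨ cong (_* ½) (suc·1*1/suc≡1 (k ℕ.+ 1 ℕ.* suc k)) ⟩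
      1ℚ * ½
        ≡⟨ *-identityˡ ½ ⟩
      ½ ∎
      where open ≡-Reasoning

    dist1-halfUniform : ∀ w → dist1 w (halfUniform (2 ℕ.* suc k) S) ≡ ∑[ i < n ] ∣ w i - χ S i * u ∣
    dist1-halfUniform w = trans (sumF≡∑ (λ i → ∣ w i - halfUniform (2 ℕ.* suc k) S i ∣))
      (sum-cong-≗ λ i → cong (λ h → ∣ w i - h ∣) (halfUniform≡χ* (2 ℕ.* suc k) S i))

    16ε+ε≡17ε : + 4 / 1 * (+ 4 / 1 * ε) + ε ≡ + 17 / 1 * ε
    16ε+ε≡17ε = solve 1 (λ e → con (+ 4 / 1) :* (con (+ 4 / 1) :* e) :+ e := con (+ 17 / 1) :* e) refl ε

    dist-xˡ : dist1 xˡ (halfUniform (2 ℕ.* suc k) S) ≤ + 17 / 1 * ε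
    dist-xˡ = begin
      dist1 xˡ (halfUniform (2 ℕ.* suc k) S)
        ≡⟨ dist1-halfUniform xˡ ⟩
      ∑[ i < n ] ∣ xˡ i - χ S i * u ∣
        ≤⟨ concentration S T size-S T⊆S size-T T-onto xˡ (off-support supp-xˡ) (+ 4 / 1 * ε) balanced u ⟩
      + 4 / 1 * (+ 4 / 1 * ε) + ∣ a - (∑[ i < n ] χ S i) * u ∣
        ≡⟨ cong (λ h → + 4 / 1 * (+ 4 / 1 * ε) + ∣ a - h ∣) ∑χS*u≡½ ⟩
      + 4 / 1 * (+ 4 / 1 * ε) + ∣ a - ½ ∣
        ≤⟨ +-monoʳ-≤ (+ 4 / 1 * (+ 4 / 1 * ε)) ∣a-½∣≤ε ⟩
      + 4 / 1 * (+ 4 / 1 * ε) + ε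
        ≡⟨ 16ε+ε≡17ε ⟩
      + 17 / 1 * ε ∎
      where
      open ≤-Reasoning
      balanced : ∀ j → a * ½ - + 4 / 1 * ε ≤ weight xˡ (T j)
      balanced j = p-q≤r⇒p-r≤q {a * ½} (a½-X≤4ε j)

    dist-yʳ : dist1 yʳ (halfUniform (2 ℕ.* suc k) S) ≤ + 17 / 1 * ε
    dist-yʳ = begin
      dist1 yʳ (halfUniform (2 ℕ.* suc k) S)
        ≡⟨ dist1-halfUniform yʳ ⟩
      ∑[ i < n ] ∣ yʳ i - χ S i * u ∣
        ≤⟨ concentration S T size-S T⊆S size-T T-onto yʳ (off-support supp-yʳ) (+ 4 / 1 * ε) balanced u ⟩
      + 4 / 1 * (+ 4 / 1 * ε) + ∣ ∑[ i < n ] yʳ i - (∑[ i < n ] χ S i) * u ∣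
        ≡⟨ cong₂ (λ s h → + 4 / 1 * (+ 4 / 1 * ε) + ∣ s - h ∣) ∑-right-y ∑χS*u≡½ ⟩
      + 4 / 1 * (+ 4 / 1 * ε) + ∣ (1ℚ - b) - ½ ∣
        ≤⟨ +-monoʳ-≤ (+ 4 / 1 * (+ 4 / 1 * ε)) ∣[1-b]-½∣≤ε ⟩
      + 4 / 1 * (+ 4 / 1 * ε) + ε
        ≡⟨ 16ε+ε≡17ε ⟩
      + 17 / 1 * ε ∎
      where
      open ≤-Reasoning
      balanced : ∀ j → ∑[ i < n ] yʳ i * ½ - + 4 / 1 * ε ≤ weight yʳ (T j)
      balanced j = subst (λ s → s * ½ - + 4 / 1 * ε ≤ weight yʳ (T j)) (sym ∑-right-y)
                         (p-q≤r⇒p-r≤q {(1ℚ - b) * ½} ([1-b]½-Q≤4ε j))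

    equilibrium-concentrates : (SuppIn xˡ S × SuppIn yʳ S) ×
                               (dist1 xˡ (halfUniform (2 ℕ.* suc k) S) ≤ + 17 / 1 * ε ×
                                dist1 yʳ (halfUniform (2 ℕ.* suc k) S) ≤ + 17 / 1 * ε)
    equilibrium-concentrates = (supp-xˡ , supp-yʳ) , (dist-xˡ , dist-yʳ)

open import Data.Nat using (ℕ; suc; _*_; _+_)
open import Data.Nat.Combinatorics using (_C_)
open import Data.Integer using (+_)
open import Data.Rational using (ℚ; 0ℚ; _≤_; _<_; _/_) renaming (_*_ to _*ℚ_)
open import Data.Fin using (Fin)
open import Data.Fin.Subset using (Subset; _⊆_; ∣_∣)
open import Data.Product using (_×_; ∃; proj₁; proj₂)
open import Data.Nat.Properties using (+-identityʳ)
open import Relation.Binary.PropositionalEquality using (_≡_; trans; cong)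
open import Function using (_∘_)

mainTheorem19 :
    (k' : ℕ) →
    (S : Subset ((2 * suc k') C suc k')) → ∣ S ∣ ≡ 2 * suc k' →
    (T : Fin ((2 * suc k') C suc k') → Subset ((2 * suc k') C suc k')) →
    (∀ j → T j ⊆ S × ∣ T j ∣ ≡ suc k') →
    (∀ i j → T i ≡ T j → i ≡ j) →
    (∀ (U : Subset ((2 * suc k') C suc k')) → U ⊆ S → ∣ U ∣ ≡ suc k' → ∃ λ j → T j ≡ U) →
    (ε : ℚ) → 0ℚ ≤ ε → ε < + 1 / 3 →
    (x y : Fin (((2 * suc k') C suc k') + ((2 * suc k') C suc k')) → ℚ) →
    IsWNE ε (R-mat S T) (C-mat S T) x y →
    (SuppIn (left x) S × SuppIn (right y) S)
    × (dist1 (left x) (halfUniform (2 * suc k') S) ≤ (+ 17 / 1) *ℚ ε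
       × dist1 (right y) (halfUniform (2 * suc k') S) ≤ (+ 17 / 1) *ℚ ε)
mainTheorem19 k' S ∣S∣≡2[1+k′] T T⊆S×∣T∣≡1+k′ _ T-onto ε 0≤ε ε<⅓ x y wne =
  equilibrium-concentrates ∣S∣≡[1+k′]+[1+k′] (proj₁ ∘ T⊆S×∣T∣≡1+k′) (proj₂ ∘ T⊆S×∣T∣≡1+k′) T-onto 0≤ε ε<⅓ wne
  where
  ∣S∣≡[1+k′]+[1+k′] : ∣ S ∣ ≡ suc k' + suc k'
  ∣S∣≡[1+k′]+[1+k′] = trans ∣S∣≡2[1+k′] (cong (_+_ (suc k')) (+-identityʳ (suc k')))
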